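{- For any structure $\mathfrak T\subseteq\mathcal P(\Delta)$ that is dispersed, hereditary and expandable, the structure $(\uparrow\mathfrak T)^\perp$ is adapted.
   Context: Resource terms $\Delta$ are given by $s::=x\mid\lambda x.s\mid\langle s\rangle\bar t$, with bags $\bar t=[t_1,\dots,t_n]$ finite multisets. $a^!$ is the set of bags with elements in $a$, and $\langle s\rangle\bar t_1\cdots\bar t_n$ denotes iterated application. Resource reduction $\to_r$ acts on finite formal sums with natural coefficients. It is generated by $\langle\lambda x.t\rangle[s_1,\dots,s_n]\to_r\sum_{f\in S_n}t[s_{f(1)}/x_1,\dots,s_{f(n)}/x_n]$ when $x_1,\dots,x_n$ are exactly the free occurrences of $x$ in $t$, and $\to_r 0$ otherwise. It is closed under constructors (extended linearly) and linearity. Write $t\ge s$ if $t\to_r^*a$ with $s$ in the support of $a$. Let $\uparrow a=\{t:\exists s\in a,t\ge s\}$, $\uparrow\mathfrak T=\{\uparrow a:a\in\mathfrak T\}$, and $\mathfrak S^\perp=\{a\subseteq\Delta:\forall a'\in\mathfrak S,\ a\cap a'\text{ finite}\}$. Set-level operations. For $t\in\Delta$ and a bag $\bar s$, $t\langle\bar s/x\rangle$ is the set of terms obtained by replacing bijectively the free occurrences of $x$ in $t$ by the elements of $\bar s$ (empty if the counts differ). Further, $e\langle a^!/x\rangle=\bigcup_{t\in e,\bar s\in a^!}t\langle\bar s/x\rangle$ and $\langle f\rangle a_1^!\cdots a_n^!=\{\langle s\rangle\bar t_1\cdots\bar t_n:s\in f,\bar t_i\in a_i^!\}$. Adaptedness.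 Define: - $\mathfrak S\to\mathfrak S'=\{f:\forall a\in\mathfrak S,\ \langle f\rangle a^!\in\mathfrak S'\}$. - $\mathfrak S'$ is $\mathfrak S$-saturated if for all $e,f_0,\dots,f_n\in\mathfrak S$, $\langle e\langle f_0^!/x\rangle\rangle f_1^!\cdots f_n^!\in\mathfrak S'$ implies $\langle\lambda x.e\rangle f_0^!\cdots f_n^!\in\mathfrak S'$. - $\mathcal N(\mathfrak S)=\{\{x\}:x\text{ variable}\}\cup\{\langle x\rangle a_1^!\cdots a_n^!:n>0,a_i\in\mathfrak S\}$. - $\mathfrak S$ is adapted if: it is $\mathfrak S$-saturated; $\mathcal N(\mathfrak S)\subseteq(\mathfrak S\to\mathcal N(\mathfrak S))\subseteq(\mathcal N(\mathfrak S)\to\mathfrak S)\subseteq\mathfrak S$; and it is closed under binary unions. Height: $h(x)=1$, $h(\lambda x.s)=1+h(s)$, $h(\langle s_0\rangle[s_1,\dots,s_n])=1+\max_{0\le i\le n}h(s_i)$. - A structure is dispersed if each element $a$ satisfies: for every $n$ and finite set of variables $V$, $\{s\in a:h(s)\le n,\mathrm{fv}(s)\subseteq V\}$ is finite. - Projections: for $x\notin\mathrm{fv}(s)$, $\pi_x(s)=\{t\}$ if $s=\lambda x.t$, else $\emptyset$. If $s=\langle t\rangle\bar u$ then $\pi_0(s)=\{t\}$ and $\pi_1(s)=$ the set of elements of $\bar u$; otherwise both are $\emptyset$. These extend to sets by union. - A structure is hereditary if it is closed under subsets and under $\pi_0$, $\pi_1$, and $\pi_x$ for all variables $x\notin\mathrm{fv}(a)$.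 - A structure is expandable if $a\in\mathfrak T$ implies $\{\langle s\rangle[x]:s\in a\}\in\mathfrak T$ for every variable $x$. -}

module Defs where

open import Data.Nat using (ℕ; zero; suc; _≤_; _⊔_; _≡ᵇ_)
open import Data.Fin using (Fin; zero; suc)
open import Data.Bool using (if_then_else_)
open import Data.List using (List; []; _∷_; _++_)
open import Data.List.Relation.Unary.All using (All)
open import Data.List.Relation.Unary.Any using (Any)
open import Data.List.Membership.Propositional using (_∈_)
open import Data.List.Relation.Binary.Permutation.Propositional using (_↭_)
open import Data.Product using (Σ; ∃; _×_; _,_)
open import Data.Sum using (_⊎_)
open import Relation.Binary.PropositionalEquality using (_≡_; _≢_)
open import Relation.Nullary using (¬_)
open import Relation.Binary.Construct.Closure.ReflexiveTransitive using (Star)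

-- Resource terms, locally nameless: free variables are names (ℕ),
-- bound variables are indices (Fin n, zero = innermost binder).
-- Bags are represented by lists, considered up to permutation (see _≈_).

data Tm (n : ℕ) : Set where
  fv  : ℕ → Tm n
  bv  : Fin n → Tm n
  lam : Tm (suc n) → Tm n
  app : Tm n → List (Tm n) → Tm n

Δ : Set
Δ = Tm 0

liftR : ∀ {m n} → (Fin m → Fin n) → Fin (suc m) → Fin (suc n)
liftR ρ zero    = zero
liftR ρ (suc i) = suc (ρ i)

mutual
  ren : ∀ {m n} → (Fin m → Fin n) → Tm m → Tm n
  ren ρ (fv x)    = fv x
  ren ρ (bv i)    = bv (ρ i)
  ren ρ (lam b)   = lam (ren (liftR ρ) b)
  ren ρ (app t L) = app (ren ρ t) (renL ρ L)

  renL : ∀ {m n} → (Fin m → Fin n) → List (Tm m) → List (Tm n)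
  renL ρ []      = []
  renL ρ (t ∷ L) = ren ρ t ∷ renL ρ L

wk : ∀ {n} → Tm n → Tm (suc n)
wk = ren suc

wkL : ∀ {n} → List (Tm n) → List (Tm (suc n))
wkL = renL suc

liftS : ∀ {m n} → (Fin m → Tm n) → Fin (suc m) → Tm (suc n)
liftS σ zero    = bv zero
liftS σ (suc i) = wk (σ i)

mutual
  sub : ∀ {m n} → (Fin m → Tm n) → (ℕ → Tm n) → Tm m → Tm n
  sub σ τ (fv x)    = τ x
  sub σ τ (bv i)    = σ i
  sub σ τ (lam b)   = lam (sub (liftS σ) (λ y → wk (τ y)) b)
  sub σ τ (app t L) = app (sub σ τ t) (subL σ τ L)

  subL : ∀ {m n} → (Fin m → Tm n) → (ℕ → Tm n) → List (Tm m) → List (Tm n)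
  subL σ τ []      = []
  subL σ τ (t ∷ L) = sub σ τ t ∷ subL σ τ L

openWith : ∀ {n} → ℕ → Tm (suc n) → Tm n
openWith x b = sub (λ { zero → fv x ; (suc i) → bv i }) fv b

-- closing: abstract the name x, so that  λx.t  =  lam (closeWith x t)
closeWith : ∀ {n} → ℕ → Tm n → Tm (suc n)
closeWith x t = sub (λ i → bv (suc i)) (λ y → if y ≡ᵇ x then bv zero else fv y) t

data Occ (x : ℕ) : ∀ {n} → Tm n → Set where
  here : ∀ {n} → Occ x {n} (fv x)
  lam  : ∀ {n} {b : Tm (suc n)} → Occ x b → Occ x (lam b)
  appH : ∀ {n} {t : Tm n} {L} → Occ x t → Occ x (app t L)
  appB : ∀ {n} {t : Tm n} {L} → Any (Occ x) L → Occ x (app t L)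

mutual
  h : ∀ {n} → Tm n → ℕ
  h (fv _)    = 1
  h (bv _)    = 1
  h (lam b)   = suc (h b)
  h (app t L) = suc (h t ⊔ hL L)

  hL : ∀ {n} → List (Tm n) → ℕ
  hL []      = 0
  hL (t ∷ L) = h t ⊔ hL L

mutual
  data _≈_ {n : ℕ} : Tm n → Tm n → Set where
    fv≈  : ∀ {x} → fv x ≈ fv x
    bv≈  : ∀ {i} → bv i ≈ bv i
    lam≈ : ∀ {b b'} → b ≈ b' → lam b ≈ lam b'
    app≈ : ∀ {t t' L M} → t ≈ t' → L ≈ᴮ M → app t L ≈ app t' M

  data _≈ᴮ_ {n : ℕ} : List (Tm n) → List (Tm n) → Set where
    bag≈ : ∀ {L L' M} → L ≈ᴾ L' → L' ↭ M → L ≈ᴮ M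

  data _≈ᴾ_ {n : ℕ} : List (Tm n) → List (Tm n) → Set where
    []≈ : [] ≈ᴾ []
    ∷≈  : ∀ {t t' L L'} → t ≈ t' → L ≈ᴾ L' → (t ∷ L) ≈ᴾ (t' ∷ L')

-- Rep x t L u : u is obtained from t by replacing bijectively the free
-- occurrences of x by the elements of the bag L  (u ∈ t⟨L/x⟩)
mutual
  data Rep (x : ℕ) {n : ℕ} : Tm n → List (Tm n) → Tm n → Set where
    rx   : ∀ {s} → Rep x (fv x) (s ∷ []) s
    ry   : ∀ {y} → y ≢ x → Rep x (fv y) [] (fv y)
    rb   : ∀ {i} → Rep x (bv i) [] (bv i)
    rlam : ∀ {b L b'} → Rep x b (wkL L) b' → Rep x (lam b) L (lam b')
    rapp : ∀ {t M L L₁ L₂ t' M'} → L ↭ (L₁ ++ L₂) →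
           Rep x t L₁ t' → RepL x M L₂ M' → Rep x (app t M) L (app t' M')

  data RepL (x : ℕ) {n : ℕ} : List (Tm n) → List (Tm n) → List (Tm n) → Set where
    []r : RepL x [] [] []
    ∷r  : ∀ {m M L L₁ L₂ m' M'} → L ↭ (L₁ ++ L₂) →
          Rep x m L₁ m' → RepL x M L₂ M' → RepL x (m ∷ M) L (m' ∷ M')

-- One step of resource reduction, at the level of supports:
-- t ↝ u  iff  t →r a  (one step) with u in the support of a.
data _↝_ {n : ℕ} : Tm n → Tm n → Set where
  β    : ∀ {b L u} x → ¬ Occ x (lam b) → ¬ Any (Occ x) L →
         Rep x (openWith x b) L u → app (lam b) L ↝ u
  lam↝ : ∀ {b b'} → b ↝ b' → lam b ↝ lam b'
  appH↝ : ∀ {t t' L} → t ↝ t' → app t L ↝ app t' L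
  appB↝ : ∀ {t L₁ L₂ u u'} → u ↝ u' → app t (L₁ ++ u ∷ L₂) ↝ app t (L₁ ++ u' ∷ L₂)

-- t ≥ s : t →r* a with s in the support of a
_≥_ : Δ → Δ → Set
t ≥ s = ∃ λ u → Star _↝_ t u × u ≈ s

TmSet : Set₁
TmSet = Δ → Set

Struct : Set₂
Struct = TmSet → Set₁

_⊆_ : TmSet → TmSet → Set
a ⊆ b = ∀ {t} → a t → b t

_∩_ : TmSet → TmSet → TmSet
(a ∩ b) t = a t × b t

_∪_ : TmSet → TmSet → TmSet
(a ∪ b) t = a t ⊎ b t

_⊑_ : TmSet → TmSet → Set
a ⊑ b = ∀ {t} → a t → ∃ λ t' → b t' × t ≈ t'

_≋_ : TmSet → TmSet → Set
a ≋ b = (a ⊑ b) × (b ⊑ a)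

Finite : TmSet → Set
Finite a = ∃ λ (F : List Δ) → ∀ {t} → a t → Any (t ≈_) F

single : Δ → TmSet
single s t = t ≈ s

_⊆S_ : Struct → Struct → Set₁
𝔖 ⊆S 𝔖' = ∀ a → 𝔖 a → 𝔖' a

↑ : TmSet → TmSet
↑ a t = ∃ λ s → a s × t ≥ s

↑S : Struct → Struct
↑S 𝔗 c = ∃ λ a → 𝔗 a × c ≋ ↑ a

_⊥ : Struct → Struct
(𝔖 ⊥) a = ∀ a' → 𝔖 a' → Finite (a ∩ a')

appS : TmSet → TmSet → TmSet
appS f a t = ∃ λ s → ∃ λ L → f s × All a L × t ≡ app s L

appsS : TmSet → List TmSet → TmSet
appsS f []       = f
appsS f (a ∷ as) = appsS (appS f a) as

repS : TmSet → ℕ → TmSet → TmSet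
repS e x a t = ∃ λ s → ∃ λ L → e s × All a L × Rep x s L t

lamS : ℕ → TmSet → TmSet
lamS x e t = ∃ λ s → e s × t ≡ lam (closeWith x s)

_⇒S_ : Struct → Struct → Struct
(𝔖 ⇒S 𝔖') f = ∀ a → 𝔖 a → 𝔖' (appS f a)

Saturated : Struct → Struct → Set₁
Saturated 𝔖 𝔖' = ∀ (x : ℕ) (e f₀ : TmSet) (fs : List TmSet) →
  𝔖 e → 𝔖 f₀ → All 𝔖 fs →
  𝔖' (appsS (repS e x f₀) fs) → 𝔖' (appsS (appS (lamS x e) f₀) fs)

𝒩 : Struct → Struct
𝒩 𝔖 c = (∃ λ x → c ≋ single (fv x))
      ⊎ (∃ λ x → Σ TmSet λ a₁ → Σ (List TmSet) λ as →
           All 𝔖 (a₁ ∷ as) × c ≋ appsS (single (fv x)) (a₁ ∷ as))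

Adapted : Struct → Set₁
Adapted 𝔖 = Saturated 𝔖 𝔖
          × (𝒩 𝔖 ⊆S (𝔖 ⇒S 𝒩 𝔖))
          × ((𝔖 ⇒S 𝒩 𝔖) ⊆S (𝒩 𝔖 ⇒S 𝔖))
          × ((𝒩 𝔖 ⇒S 𝔖) ⊆S 𝔖)
          × (∀ a b → 𝔖 a → 𝔖 b → 𝔖 (a ∪ b))

FvIn : Δ → List ℕ → Set
FvIn s V = ∀ x → Occ x s → x ∈ V

Dispersed : Struct → Set₁
Dispersed 𝔗 = ∀ a → 𝔗 a → ∀ (n : ℕ) (V : List ℕ) →
  Finite (λ s → a s × h s ≤ n × FvIn s V)

π₀ : TmSet → TmSet
π₀ a t = ∃ λ L → a (app t L)

π₁ : TmSet → TmSet
π₁ a t = ∃ λ s → ∃ λ L → a (app s L) × t ∈ L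

-- π_x, used when x ∉ fv(a):  π_x(λx.t) = t
πv : ℕ → TmSet → TmSet
πv x a t = ∃ λ b → a (lam b) × t ≡ openWith x b

NotFree : ℕ → TmSet → Set
NotFree x a = ∀ {s} → a s → ¬ Occ x s

Hereditary : Struct → Set₁
Hereditary 𝔗 = (∀ a b → 𝔗 a → b ⊆ a → 𝔗 b)
             × (∀ a → 𝔗 a → 𝔗 (π₀ a))
             × (∀ a → 𝔗 a → 𝔗 (π₁ a))
             × (∀ x a → 𝔗 a → NotFree x a → 𝔗 (πv x a))

Expandable : Struct → Set₁
Expandable 𝔗 = ∀ a → 𝔗 a → ∀ (x : ℕ) →
  𝔗 (λ t → ∃ λ s → a s × t ≡ app s (fv x ∷ []))

-- A set of terms is finite iff its elements have bounded size and finitely many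
-- free names, so X ∈ (↑𝔗)^⊥ means that X ∩ ↑a is bounded in this sense for every a ∈ 𝔗.
-- The heart of the argument bounds the spines ⟨h⟩c₁^!⋯cₙ^! with cᵢ ∈ (↑𝔗)^⊥: a term
-- ⟨s⟩[t₁,…,tₖ] reducing into a without contracting at the root has its head reducing
-- into π₀a and its arguments into π₁a, which bounds s and the tᵢ by induction; and k is
-- bounded because the reduct ⟨s₀⟩[u₁,…,uₖ] ∈ a has bounded height and free names, while
-- a is dispersed. For saturation, a reduction of ⟨λx.e⟩f₀^!⋯fₙ^! either never fires the
-- head redex, and then the body is controlled through π_x(a), or it fires it; postponing
-- the reductions in the body past that β-step, the term is then at most about twice as
-- large as a term of ⟨e⟨f₀^!/x⟩⟩f₁^!⋯fₙ^! reducing into a, since linear substitution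
-- erases nothing. The conditions on 𝒩 follow from the bound for variable-headed spines,
-- together with the empty set and expandability.

module Submission where

open import Defs
open import Data.Nat using (ℕ; zero; suc; _+_; _*_; _≤_; z≤n; s≤s; _⊔_; _≡ᵇ_)
open import Data.Bool using (true; false; if_then_else_; T)
open import Data.Unit using (⊤; tt)
open import Data.Nat.Properties
  using (≤-refl; ≤-trans; ≤-reflexive; m≤m+n; m≤n+m; +-mono-≤; ⊔-mono-≤; m⊔n≤m+n; +-comm; +-assoc; ⊔-lub; +-identityʳ; n≤1+n; m≤m⊔n; +-monoˡ-≤; +-monoʳ-≤; *-monoʳ-≤; *-monoˡ-≤; ≡ᵇ⇒≡; ≡⇒≡ᵇ; m≤n⇒m≤n⊔o; m≤n⇒m≤o⊔n; n≮n; module ≤-Reasoning)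
open import Data.Nat.Tactic.RingSolver using (solve-∀)
open import Data.Fin using (Fin; zero; suc; punchIn; punchOut)
open import Data.Fin.Properties using (punchIn-injective; punchInᵢ≢i; punchIn-punchOut; suc-injective; _≟_)
open import Data.List using (List; []; _∷_; _++_; length; map; concatMap; allFin; cartesianProductWith)
open import Data.List.Properties using (∷-injective; ++-assoc; length-++)
open import Data.List.Relation.Unary.Any using (Any; here; there)
import Data.List.Relation.Unary.Any.Properties as Any
open import Data.List.Membership.Propositional using (_∈_; find; lose)
open import Data.List.Membership.Propositional.Properties
  using (∈-++⁺ˡ; ∈-++⁺ʳ; ∈-map⁺; ∈-allFin; ∈-cartesianProductWith⁺)
open import Data.List.Relation.Binary.Pointwise using (Pointwise; []; _∷_; Pointwise-length)
import Data.List.Relation.Binary.Pointwise as PW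
open import Data.List.Relation.Unary.All using (All; []; _∷_)
import Data.List.Relation.Unary.All as All
import Data.List.Relation.Unary.All.Properties as All
open import Data.List.Relation.Binary.Permutation.Propositional
  using (_↭_; ↭-sym; ↭-trans; ↭-reflexive; refl; prep; swap; trans)
open import Data.List.Relation.Binary.Permutation.Propositional.Properties
  using (Any-resp-↭; ∈-resp-↭; ↭-length; map⁺; ++⁺ˡ; ++⁺ʳ; shifts; ↭-empty-inv; ↭-singleton-inv; ↭-map-inv; ++⁺; ++-identityʳ)
open import Data.Product using (∃; ∃₂; _×_; _,_; proj₁; proj₂)
open import Relation.Binary.PropositionalEquality using (_≡_; _≢_; refl; sym; cong; cong₂; subst; subst₂; module ≡-Reasoning) renaming (trans to ≡-trans)
open import Function using (_∘_; id)
open import Data.Empty using (⊥-elim) renaming (⊥ to 𝟘)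
open import Data.Sum using (_⊎_; inj₁; inj₂; [_,_]′)
import Data.Sum as Sum
open import Relation.Nullary using (¬_; yes; no)
open import Relation.Binary.Construct.Closure.ReflexiveTransitive using (Star; ε; _◅_; _◅◅_; gmap)

module _ {A B : Set} {R : A → B → Set} where

  Pointwise-++⁻ʳ : ∀ {xs} ys₁ {ys₂} → Pointwise R xs (ys₁ ++ ys₂) →
    ∃₂ λ xs₁ xs₂ → xs ≡ xs₁ ++ xs₂ × Pointwise R xs₁ ys₁ × Pointwise R xs₂ ys₂
  Pointwise-++⁻ʳ [] rs = [] , _ , refl , [] , rs
  Pointwise-++⁻ʳ (_ ∷ ys₁) (r ∷ rs) with Pointwise-++⁻ʳ ys₁ rs
  ... | xs₁ , xs₂ , refl , rs₁ , rs₂ = _ ∷ xs₁ , xs₂ , refl , r ∷ rs₁ , rs₂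

  ↭-Pointwise-commute : ∀ {xs ys zs} → xs ↭ ys → Pointwise R ys zs →
    ∃ λ ws → Pointwise R xs ws × ws ↭ zs
  ↭-Pointwise-commute refl rs = _ , rs , refl
  ↭-Pointwise-commute (prep _ p) (r ∷ rs) with ↭-Pointwise-commute p rs
  ... | _ , rs' , p' = _ , r ∷ rs' , prep _ p'
  ↭-Pointwise-commute (swap _ _ p) (r ∷ r' ∷ rs) with ↭-Pointwise-commute p rs
  ... | _ , rs' , p' = _ , r' ∷ r ∷ rs' , swap _ _ p'
  ↭-Pointwise-commute (trans p q) rs with ↭-Pointwise-commute q rs
  ... | _ , rs' , q' with ↭-Pointwise-commute p rs'
  ... | _ , rs'' , p' = _ , rs'' , ↭-trans p' q'

  Pointwise-↭-commute : ∀ {xs ys zs} → Pointwise R xs ys → ys ↭ zs →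
    ∃ λ ws → xs ↭ ws × Pointwise R ws zs
  Pointwise-↭-commute rs refl = _ , refl , rs
  Pointwise-↭-commute (r ∷ rs) (prep _ p) with Pointwise-↭-commute rs p
  ... | _ , p' , rs' = _ , prep _ p' , r ∷ rs'
  Pointwise-↭-commute (r ∷ r' ∷ rs) (swap _ _ p) with Pointwise-↭-commute rs p
  ... | _ , p' , rs' = _ , swap _ _ p' , r' ∷ r ∷ rs'
  Pointwise-↭-commute rs (trans p q) with Pointwise-↭-commute rs p
  ... | _ , p' , rs' with Pointwise-↭-commute rs' q
  ... | _ , q' , rs'' = _ , ↭-trans p' q' , rs''

  Pointwise-∈ˡ : ∀ {xs ys x} → Pointwise R xs ys → x ∈ xs → ∃ λ y → y ∈ ys × R x y
  Pointwise-∈ˡ (r ∷ rs) (here refl) = _ , here refl , r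
  Pointwise-∈ˡ (r ∷ rs) (there i) with Pointwise-∈ˡ rs i
  ... | y , j , r' = y , there j , r'

  Pointwise-∈ʳ : ∀ {xs ys y} → Pointwise R xs ys → y ∈ ys → ∃ λ x → x ∈ xs × R x y
  Pointwise-∈ʳ (r ∷ rs) (here refl) = _ , here refl , r
  Pointwise-∈ʳ (r ∷ rs) (there i) with Pointwise-∈ʳ rs i
  ... | x , j , r' = x , there j , r'

map-≡-++⁻ : ∀ {A B : Set} (f : A → B) xs ys₁ {ys₂} → map f xs ≡ ys₁ ++ ys₂ →
  ∃₂ λ xs₁ xs₂ → xs ≡ xs₁ ++ xs₂ × ys₁ ≡ map f xs₁ × ys₂ ≡ map f xs₂
map-≡-++⁻ f xs [] eq = [] , xs , refl , refl , sym eq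
map-≡-++⁻ f (x ∷ xs) (_ ∷ ys₁) eq with ∷-injective eq
... | refl , eq' with map-≡-++⁻ f xs ys₁ eq'
... | xs₁ , xs₂ , refl , refl , eq₂ = x ∷ xs₁ , xs₂ , refl , refl , eq₂

mutual
  size : ∀ {n} → Tm n → ℕ
  size (fv _)    = 1
  size (bv _)    = 1
  size (lam b)   = suc (size b)
  size (app t L) = suc (size t + sizeL L)

  sizeL : ∀ {n} → List (Tm n) → ℕ
  sizeL []      = 0
  sizeL (t ∷ L) = size t + sizeL L

sizeL-++ : ∀ {n} (L M : List (Tm n)) → sizeL (L ++ M) ≡ sizeL L + sizeL M
sizeL-++ []      M = refl
sizeL-++ (t ∷ L) M = ≡-trans (cong (size t +_) (sizeL-++ L M)) (sym (+-assoc (size t) _ _))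

sizeL-↭ : ∀ {n} {L M : List (Tm n)} → L ↭ M → sizeL L ≡ sizeL M
sizeL-↭ refl = refl
sizeL-↭ (prep t p) = cong (size t +_) (sizeL-↭ p)
sizeL-↭ {L = t ∷ u ∷ L} (swap t u p) = begin
  size t + (size u + sizeL L)   ≡⟨ sym (+-assoc (size t) _ _) ⟩
  (size t + size u) + sizeL L   ≡⟨ cong (_+ sizeL L) (+-comm (size t) _) ⟩
  (size u + size t) + sizeL L   ≡⟨ +-assoc (size u) _ _ ⟩
  size u + (size t + sizeL L)   ≡⟨ cong (λ k → size u + (size t + k)) (sizeL-↭ p) ⟩
  _                             ∎
  where open ≡-Reasoning
sizeL-↭ (trans p q) = ≡-trans (sizeL-↭ p) (sizeL-↭ q)

sizeL-↭-++ : ∀ {n} {L} (L₁ : List (Tm n)) {L₂} → L ↭ L₁ ++ L₂ → sizeL L ≡ sizeL L₁ + sizeL L₂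
sizeL-↭-++ L₁ {L₂} p = ≡-trans (sizeL-↭ p) (sizeL-++ L₁ L₂)

length≤sizeL : ∀ {n} (L : List (Tm n)) → length L ≤ sizeL L
length≤sizeL []          = z≤n
length≤sizeL (fv _ ∷ L)    = s≤s (length≤sizeL L)
length≤sizeL (bv _ ∷ L)    = s≤s (length≤sizeL L)
length≤sizeL (lam _ ∷ L)   = s≤s (≤-trans (length≤sizeL L) (m≤n+m _ _))
length≤sizeL (app _ _ ∷ L) = s≤s (≤-trans (length≤sizeL L) (m≤n+m _ _))

∈⇒size≤sizeL : ∀ {n} {t : Tm n} {L} → t ∈ L → size t ≤ sizeL L
∈⇒size≤sizeL (here refl) = m≤m+n _ _
∈⇒size≤sizeL {L = u ∷ L} (there i) = ≤-trans (∈⇒size≤sizeL i) (m≤n+m _ _)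

sizeL≤length*max : ∀ {n} (L : List (Tm n)) {N} → (∀ {t} → t ∈ L → size t ≤ N) → sizeL L ≤ length L * N
sizeL≤length*max []      f = z≤n
sizeL≤length*max (t ∷ L) f = +-mono-≤ (f (here refl)) (sizeL≤length*max L (f ∘ there))

mutual
  h≤size : ∀ {n} (t : Tm n) → h t ≤ size t
  h≤size (fv _)    = ≤-refl
  h≤size (bv _)    = ≤-refl
  h≤size (lam b)   = s≤s (h≤size b)
  h≤size (app t L) = s≤s (≤-trans (⊔-mono-≤ (h≤size t) (hL≤sizeL L)) (m⊔n≤m+n (size t) (sizeL L)))

  hL≤sizeL : ∀ {n} (L : List (Tm n)) → hL L ≤ sizeL L
  hL≤sizeL []      = z≤n
  hL≤sizeL (t ∷ L) = ≤-trans (⊔-mono-≤ (h≤size t) (hL≤sizeL L)) (m⊔n≤m+n (size t) (sizeL L))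

mutual
  ≈-refl : ∀ {n} (t : Tm n) → t ≈ t
  ≈-refl (fv x)    = fv≈
  ≈-refl (bv i)    = bv≈
  ≈-refl (lam b)   = lam≈ (≈-refl b)
  ≈-refl (app t L) = app≈ (≈-refl t) (bag≈ (≈ᴾ-refl L) refl)

  ≈ᴾ-refl : ∀ {n} (L : List (Tm n)) → L ≈ᴾ L
  ≈ᴾ-refl []      = []≈
  ≈ᴾ-refl (t ∷ L) = ∷≈ (≈-refl t) (≈ᴾ-refl L)

≈ᴮ-refl : ∀ {n} (L : List (Tm n)) → L ≈ᴮ L
≈ᴮ-refl L = bag≈ (≈ᴾ-refl L) refl

≈ᴾ⇒Pointwise : ∀ {n} {L M : List (Tm n)} → L ≈ᴾ M → Pointwise _≈_ L M
≈ᴾ⇒Pointwise []≈        = []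
≈ᴾ⇒Pointwise (∷≈ p ps) = p ∷ ≈ᴾ⇒Pointwise ps

Pointwise⇒≈ᴾ : ∀ {n} {L M : List (Tm n)} → Pointwise _≈_ L M → L ≈ᴾ M
Pointwise⇒≈ᴾ []       = []≈
Pointwise⇒≈ᴾ (p ∷ ps) = ∷≈ p (Pointwise⇒≈ᴾ ps)

mutual
  ≈-sym : ∀ {n} {t u : Tm n} → t ≈ u → u ≈ t
  ≈-sym fv≈        = fv≈
  ≈-sym bv≈        = bv≈
  ≈-sym (lam≈ p)   = lam≈ (≈-sym p)
  ≈-sym (app≈ p q) = app≈ (≈-sym p) (≈ᴮ-sym q)

  ≈ᴮ-sym : ∀ {n} {L M : List (Tm n)} → L ≈ᴮ M → M ≈ᴮ L
  ≈ᴮ-sym (bag≈ p q) with ↭-Pointwise-commute (↭-sym q) (≈ᴾ⇒Pointwise (≈ᴾ-sym p))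
  ... | _ , p' , q' = bag≈ (Pointwise⇒≈ᴾ p') q'

  ≈ᴾ-sym : ∀ {n} {L M : List (Tm n)} → L ≈ᴾ M → M ≈ᴾ L
  ≈ᴾ-sym []≈        = []≈
  ≈ᴾ-sym (∷≈ p ps) = ∷≈ (≈-sym p) (≈ᴾ-sym ps)

mutual
  ≈-trans : ∀ {n} {t u v : Tm n} → t ≈ u → u ≈ v → t ≈ v
  ≈-trans fv≈ fv≈ = fv≈
  ≈-trans bv≈ bv≈ = bv≈
  ≈-trans (lam≈ p) (lam≈ q) = lam≈ (≈-trans p q)
  ≈-trans (app≈ p (bag≈ p₁ q₁)) (app≈ q (bag≈ p₂ q₂)) with ↭-Pointwise-commute q₁ (≈ᴾ⇒Pointwise p₂)
  ... | _ , p' , q' = app≈ (≈-trans p q) (bag≈ (≈ᴾ-trans p₁ (Pointwise⇒≈ᴾ p')) (↭-trans q' q₂))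

  ≈ᴾ-trans : ∀ {n} {L M K : List (Tm n)} → L ≈ᴾ M → M ≈ᴾ K → L ≈ᴾ K
  ≈ᴾ-trans []≈ []≈ = []≈
  ≈ᴾ-trans (∷≈ p ps) (∷≈ q qs) = ∷≈ (≈-trans p q) (≈ᴾ-trans ps qs)

≈ᴮ-∈ : ∀ {n} {L M : List (Tm n)} {t} → L ≈ᴮ M → t ∈ L → ∃ λ t' → t' ∈ M × t ≈ t'
≈ᴮ-∈ (bag≈ p q) i with Pointwise-∈ˡ (≈ᴾ⇒Pointwise p) i
... | t' , j , e = t' , ∈-resp-↭ q j , e

≈ᴮ-length : ∀ {n} {L M : List (Tm n)} → L ≈ᴮ M → length L ≡ length M
≈ᴮ-length (bag≈ p q) = ≡-trans (Pointwise-length (≈ᴾ⇒Pointwise p)) (↭-length q)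

mutual
  size-≈ : ∀ {n} {t u : Tm n} → t ≈ u → size t ≡ size u
  size-≈ fv≈ = refl
  size-≈ bv≈ = refl
  size-≈ (lam≈ p) = cong suc (size-≈ p)
  size-≈ (app≈ p (bag≈ q r)) = cong suc (cong₂ _+_ (size-≈ p) (≡-trans (sizeᴾ-≈ q) (sizeL-↭ r)))

  sizeᴾ-≈ : ∀ {n} {L M : List (Tm n)} → L ≈ᴾ M → sizeL L ≡ sizeL M
  sizeᴾ-≈ []≈ = refl
  sizeᴾ-≈ (∷≈ p ps) = cong₂ _+_ (size-≈ p) (sizeᴾ-≈ ps)

mutual
  Occ-≈ : ∀ {x n} {t u : Tm n} → t ≈ u → Occ x t → Occ x u
  Occ-≈ fv≈ o = o
  Occ-≈ (lam≈ p) (lam o) = lam (Occ-≈ p o)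
  Occ-≈ (app≈ p q) (appH o) = appH (Occ-≈ p o)
  Occ-≈ (app≈ p (bag≈ q r)) (appB o) = appB (Any-resp-↭ r (Occᴾ-≈ q o))

  Occᴾ-≈ : ∀ {x n} {L M : List (Tm n)} → L ≈ᴾ M → Any (Occ x) L → Any (Occ x) M
  Occᴾ-≈ (∷≈ p ps) (here o)  = here (Occ-≈ p o)
  Occᴾ-≈ (∷≈ p ps) (there o) = there (Occᴾ-≈ ps o)

_≼_ : ∀ {n} → Tm n → Tm n → Set
u ≼ t = size u ≤ size t × (∀ {z} → Occ z u → Occ z t)

≼-refl : ∀ {n} {t : Tm n} → t ≼ t
≼-refl = ≤-refl , λ o → o

≼-trans : ∀ {n} {t u v : Tm n} → t ≼ u → u ≼ v → t ≼ v
≼-trans (s₁ , o₁) (s₂ , o₂) = ≤-trans s₁ s₂ , λ o → o₂ (o₁ o)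

≈⇒≼ : ∀ {n} {t u : Tm n} → t ≈ u → t ≼ u
≈⇒≼ p = ≤-reflexive (size-≈ p) , Occ-≈ p

renL≡map : ∀ {m n} (g : Fin m → Fin n) L → renL g L ≡ map (ren g) L
renL≡map g []      = refl
renL≡map g (t ∷ L) = cong (ren g t ∷_) (renL≡map g L)

subL≡map : ∀ {m n} (σ : Fin m → Tm n) τ L → subL σ τ L ≡ map (sub σ τ) L
subL≡map σ τ []      = refl
subL≡map σ τ (t ∷ L) = cong (sub σ τ t ∷_) (subL≡map σ τ L)

renL-++ : ∀ {m n} (g : Fin m → Fin n) L M → renL g (L ++ M) ≡ renL g L ++ renL g M
renL-++ g []      M = refl
renL-++ g (t ∷ L) M = cong (ren g t ∷_) (renL-++ g L M)

subL-++ : ∀ {m n} (σ : Fin m → Tm n) τ L M → subL σ τ (L ++ M) ≡ subL σ τ L ++ subL σ τ M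
subL-++ σ τ []      M = refl
subL-++ σ τ (t ∷ L) M = cong (sub σ τ t ∷_) (subL-++ σ τ L M)

renL-↭ : ∀ {m n} (g : Fin m → Fin n) {L M} → L ↭ M → renL g L ↭ renL g M
renL-↭ g {L} {M} p rewrite renL≡map g L | renL≡map g M = map⁺ (ren g) p

subL-↭ : ∀ {m n} (σ : Fin m → Tm n) τ {L M} → L ↭ M → subL σ τ L ↭ subL σ τ M
subL-↭ σ τ {L} {M} p rewrite subL≡map σ τ L | subL≡map σ τ M = map⁺ (sub σ τ) p

renL-length : ∀ {m n} (g : Fin m → Fin n) L → length (renL g L) ≡ length L
renL-length g []      = refl
renL-length g (t ∷ L) = cong suc (renL-length g L)

mutual
  ren-fuse : ∀ {m n k} {f : Fin n → Fin k} {g : Fin m → Fin n} {fg : Fin m → Fin k} →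
    (∀ j → f (g j) ≡ fg j) → ∀ t → ren f (ren g t) ≡ ren fg t
  ren-fuse e (fv x)    = refl
  ren-fuse e (bv i)    = cong bv (e i)
  ren-fuse {f = f} {g} {fg} e (lam b) = cong lam (ren-fuse e' b)
    where
    e' : ∀ j → liftR f (liftR g j) ≡ liftR fg j
    e' zero    = refl
    e' (suc j) = cong suc (e j)
  ren-fuse e (app t L) = cong₂ app (ren-fuse e t) (renL-fuse e L)

  renL-fuse : ∀ {m n k} {f : Fin n → Fin k} {g : Fin m → Fin n} {fg : Fin m → Fin k} →
    (∀ j → f (g j) ≡ fg j) → ∀ L → renL f (renL g L) ≡ renL fg L
  renL-fuse e []      = refl
  renL-fuse e (t ∷ L) = cong₂ _∷_ (ren-fuse e t) (renL-fuse e L)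

ren-wk : ∀ {m n} {g : Fin m → Fin n} {g' : Fin (suc m) → Fin (suc n)} →
  (∀ j → g' (suc j) ≡ suc (g j)) → ∀ t → ren g' (wk t) ≡ wk (ren g t)
ren-wk e t = ≡-trans (ren-fuse e t) (sym (ren-fuse (λ _ → refl) t))

renL-wkL : ∀ {m n} {g : Fin m → Fin n} {g' : Fin (suc m) → Fin (suc n)} →
  (∀ j → g' (suc j) ≡ suc (g j)) → ∀ L → renL g' (wkL L) ≡ wkL (renL g L)
renL-wkL e L = ≡-trans (renL-fuse e L) (sym (renL-fuse (λ _ → refl) L))

mutual
  sub-ren : ∀ {m n k} {g : Fin m → Fin n} {σ' : Fin n → Tm k} {σ : Fin m → Tm k} {τ : ℕ → Tm k} →
    (∀ j → σ' (g j) ≡ σ j) → ∀ t → sub σ' τ (ren g t) ≡ sub σ τ t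
  sub-ren e (fv x) = refl
  sub-ren e (bv i) = e i
  sub-ren {g = g} {σ'} {σ} e (lam b) = cong lam (sub-ren e' b)
    where
    e' : ∀ j → liftS σ' (liftR g j) ≡ liftS σ j
    e' zero    = refl
    e' (suc j) = cong wk (e j)
  sub-ren e (app t L) = cong₂ app (sub-ren e t) (subL-ren e L)

  subL-ren : ∀ {m n k} {g : Fin m → Fin n} {σ' : Fin n → Tm k} {σ : Fin m → Tm k} {τ : ℕ → Tm k} →
    (∀ j → σ' (g j) ≡ σ j) → ∀ L → subL σ' τ (renL g L) ≡ subL σ τ L
  subL-ren e []      = refl
  subL-ren e (t ∷ L) = cong₂ _∷_ (sub-ren e t) (subL-ren e L)

mutual
  ren-sub : ∀ {m n k} {g : Fin n → Fin k} {σ : Fin m → Tm n} {τ : ℕ → Tm n} {σ' : Fin m → Tm k} {τ' : ℕ → Tm k} →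
    (∀ j → ren g (σ j) ≡ σ' j) → (∀ y → ren g (τ y) ≡ τ' y) → ∀ t → ren g (sub σ τ t) ≡ sub σ' τ' t
  ren-sub eσ eτ (fv x) = eτ x
  ren-sub eσ eτ (bv i) = eσ i
  ren-sub {g = g} {σ} {τ} {σ'} {τ'} eσ eτ (lam b) = cong lam (ren-sub eσ' eτ' b)
    where
    eσ' : ∀ j → ren (liftR g) (liftS σ j) ≡ liftS σ' j
    eσ' zero    = refl
    eσ' (suc j) = ≡-trans (ren-wk (λ _ → refl) (σ j)) (cong wk (eσ j))
    eτ' : ∀ y → ren (liftR g) (wk (τ y)) ≡ wk (τ' y)
    eτ' y = ≡-trans (ren-wk (λ _ → refl) (τ y)) (cong wk (eτ y))
  ren-sub eσ eτ (app t L) = cong₂ app (ren-sub eσ eτ t) (renL-sub eσ eτ L)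

  renL-sub : ∀ {m n k} {g : Fin n → Fin k} {σ : Fin m → Tm n} {τ : ℕ → Tm n} {σ' : Fin m → Tm k} {τ' : ℕ → Tm k} →
    (∀ j → ren g (σ j) ≡ σ' j) → (∀ y → ren g (τ y) ≡ τ' y) → ∀ L → renL g (subL σ τ L) ≡ subL σ' τ' L
  renL-sub eσ eτ []      = refl
  renL-sub eσ eτ (t ∷ L) = cong₂ _∷_ (ren-sub eσ eτ t) (renL-sub eσ eτ L)

subL-liftS-wkL : ∀ {m n} (σ : Fin m → Tm n) (τ : ℕ → Tm n) L →
  subL (liftS σ) (λ y → wk (τ y)) (wkL L) ≡ wkL (subL σ τ L)
subL-liftS-wkL σ τ L = ≡-trans (subL-ren (λ _ → refl) L) (sym (renL-sub (λ _ → refl) (λ _ → refl) L))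

mutual
  ren≡sub : ∀ {m n} {g : Fin m → Fin n} {σ : Fin m → Tm n} {τ : ℕ → Tm n} →
    (∀ j → σ j ≡ bv (g j)) → (∀ y → τ y ≡ fv y) → ∀ t → ren g t ≡ sub σ τ t
  ren≡sub eσ eτ (fv x) = sym (eτ x)
  ren≡sub eσ eτ (bv i) = sym (eσ i)
  ren≡sub {g = g} {σ} {τ} eσ eτ (lam b) = cong lam (ren≡sub eσ' (λ y → cong wk (eτ y)) b)
    where
    eσ' : ∀ j → liftS σ j ≡ bv (liftR g j)
    eσ' zero    = refl
    eσ' (suc j) = cong wk (eσ j)
  ren≡sub eσ eτ (app t L) = cong₂ app (ren≡sub eσ eτ t) (renL≡subL eσ eτ L)

  renL≡subL : ∀ {m n} {g : Fin m → Fin n} {σ : Fin m → Tm n} {τ : ℕ → Tm n} →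
    (∀ j → σ j ≡ bv (g j)) → (∀ y → τ y ≡ fv y) → ∀ L → renL g L ≡ subL σ τ L
  renL≡subL eσ eτ []      = refl
  renL≡subL eσ eτ (t ∷ L) = cong₂ _∷_ (ren≡sub eσ eτ t) (renL≡subL eσ eτ L)

mutual
  size-ren : ∀ {m n} (g : Fin m → Fin n) t → size (ren g t) ≡ size t
  size-ren g (fv x)    = refl
  size-ren g (bv i)    = refl
  size-ren g (lam b)   = cong suc (size-ren (liftR g) b)
  size-ren g (app t L) = cong suc (cong₂ _+_ (size-ren g t) (sizeL-renL g L))

  sizeL-renL : ∀ {m n} (g : Fin m → Fin n) L → sizeL (renL g L) ≡ sizeL L
  sizeL-renL g []      = refl
  sizeL-renL g (t ∷ L) = cong₂ _+_ (size-ren g t) (sizeL-renL g L)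

mutual
  Occ-ren⁺ : ∀ {x m n} (g : Fin m → Fin n) {t} → Occ x t → Occ x (ren g t)
  Occ-ren⁺ g here     = here
  Occ-ren⁺ g (lam o)  = lam (Occ-ren⁺ (liftR g) o)
  Occ-ren⁺ g (appH o) = appH (Occ-ren⁺ g o)
  Occ-ren⁺ g (appB o) = appB (OccL-renL⁺ g o)

  OccL-renL⁺ : ∀ {x m n} (g : Fin m → Fin n) {L} → Any (Occ x) L → Any (Occ x) (renL g L)
  OccL-renL⁺ g {_ ∷ _} (here o)  = here (Occ-ren⁺ g o)
  OccL-renL⁺ g {_ ∷ _} (there o) = there (OccL-renL⁺ g o)

mutual
  Occ-ren⁻ : ∀ {x m n} (g : Fin m → Fin n) t → Occ x (ren g t) → Occ x t
  Occ-ren⁻ g (fv y)    here     = here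
  Occ-ren⁻ g (lam b)   (lam o)  = lam (Occ-ren⁻ (liftR g) b o)
  Occ-ren⁻ g (app t L) (appH o) = appH (Occ-ren⁻ g t o)
  Occ-ren⁻ g (app t L) (appB o) = appB (OccL-renL⁻ g L o)

  OccL-renL⁻ : ∀ {x m n} (g : Fin m → Fin n) L → Any (Occ x) (renL g L) → Any (Occ x) L
  OccL-renL⁻ g (t ∷ L) (here o)  = here (Occ-ren⁻ g t o)
  OccL-renL⁻ g (t ∷ L) (there o) = there (OccL-renL⁻ g L o)

mutual
  ren-≈ : ∀ {m n} (g : Fin m → Fin n) {t u} → t ≈ u → ren g t ≈ ren g u
  ren-≈ g fv≈ = fv≈
  ren-≈ g bv≈ = bv≈
  ren-≈ g (lam≈ p) = lam≈ (ren-≈ (liftR g) p)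
  ren-≈ g (app≈ p (bag≈ q r)) = app≈ (ren-≈ g p) (bag≈ (renᴾ-≈ g q) (renL-↭ g r))

  renᴾ-≈ : ∀ {m n} (g : Fin m → Fin n) {L M} → L ≈ᴾ M → renL g L ≈ᴾ renL g M
  renᴾ-≈ g []≈        = []≈
  renᴾ-≈ g (∷≈ p ps) = ∷≈ (ren-≈ g p) (renᴾ-≈ g ps)

mutual
  sub-≈ : ∀ {m n} (σ : Fin m → Tm n) τ {t u} → t ≈ u → sub σ τ t ≈ sub σ τ u
  sub-≈ σ τ (fv≈ {x}) = ≈-refl (τ x)
  sub-≈ σ τ (bv≈ {i}) = ≈-refl (σ i)
  sub-≈ σ τ (lam≈ p) = lam≈ (sub-≈ (liftS σ) (λ y → wk (τ y)) p)
  sub-≈ σ τ (app≈ p (bag≈ q r)) = app≈ (sub-≈ σ τ p) (bag≈ (subᴾ-≈ σ τ q) (subL-↭ σ τ r))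

  subᴾ-≈ : ∀ {m n} (σ : Fin m → Tm n) τ {L M} → L ≈ᴾ M → subL σ τ L ≈ᴾ subL σ τ M
  subᴾ-≈ σ τ []≈        = []≈
  subᴾ-≈ σ τ (∷≈ p ps) = ∷≈ (sub-≈ σ τ p) (subᴾ-≈ σ τ ps)

-- LinSub i b L v : v is b with the occurrences of the bound index i replaced bijectively
-- by the elements of the bag L, and the indices above i lowered. The reduction _⟶_ is
-- _↝_ with β stated through LinSub, so that no fresh names are involved.
mutual
  data LinSub {n : ℕ} (i : Fin (suc n)) : Tm (suc n) → List (Tm n) → Tm n → Set where
    hole  : ∀ {k s} → k ≡ i → LinSub i (bv k) (s ∷ []) s
    bound : ∀ {k j} → punchIn i j ≡ k → LinSub i (bv k) [] (bv j)
    free  : ∀ {y} → LinSub i (fv y) [] (fv y)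
    lam   : ∀ {b L b'} → LinSub (suc i) b (wkL L) b' → LinSub i (lam b) L (lam b')
    app   : ∀ {t M L L₁ L₂ t' M'} → L ↭ L₁ ++ L₂ →
            LinSub i t L₁ t' → LinSubs i M L₂ M' → LinSub i (app t M) L (app t' M')

  data LinSubs {n : ℕ} (i : Fin (suc n)) : List (Tm (suc n)) → List (Tm n) → List (Tm n) → Set where
    nil  : LinSubs i [] [] []
    cons : ∀ {m M L L₁ L₂ m' M'} → L ↭ L₁ ++ L₂ →
           LinSub i m L₁ m' → LinSubs i M L₂ M' → LinSubs i (m ∷ M) L (m' ∷ M')

data _⟶_ {n : ℕ} : Tm n → Tm n → Set where
  β⟶    : ∀ {b L u} → LinSub zero b L u → app (lam b) L ⟶ u
  lam⟶  : ∀ {b b'} → b ⟶ b' → lam b ⟶ lam b'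
  appH⟶ : ∀ {t t' L} → t ⟶ t' → app t L ⟶ app t' L
  appB⟶ : ∀ {t L₁ L₂ u u'} → u ⟶ u' → app t (L₁ ++ u ∷ L₂) ⟶ app t (L₁ ++ u' ∷ L₂)

_⟶*_ : ∀ {n} → Tm n → Tm n → Set
_⟶*_ = Star _⟶_

mutual
  LinSub-punchIn : ∀ {n} {i : Fin (suc n)} {g : Fin n → Fin (suc n)} → (∀ j → g j ≡ punchIn i j) →
    ∀ w → LinSub i (ren g w) [] w
  LinSub-punchIn e (fv x) = free
  LinSub-punchIn e (bv j) = bound (sym (e j))
  LinSub-punchIn {i = i} {g} e (lam b) = lam (LinSub-punchIn e' b)
    where
    e' : ∀ j → liftR g j ≡ punchIn (suc i) j
    e' zero    = refl
    e' (suc j) = cong suc (e j)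
  LinSub-punchIn e (app t L) = app refl (LinSub-punchIn e t) (LinSubs-punchIn e L)

  LinSubs-punchIn : ∀ {n} {i : Fin (suc n)} {g : Fin n → Fin (suc n)} → (∀ j → g j ≡ punchIn i j) →
    ∀ L → LinSubs i (renL g L) [] L
  LinSubs-punchIn e []      = nil
  LinSubs-punchIn e (t ∷ L) = cons refl (LinSub-punchIn e t) (LinSubs-punchIn e L)

mutual
  LinSub-sub : ∀ {m n} {i : Fin (suc m)} {i' : Fin (suc n)} {σ : Fin m → Tm n} {τ : ℕ → Tm n}
    {σ' : Fin (suc m) → Tm (suc n)} {τ' : ℕ → Tm (suc n)} →
    σ' i ≡ bv i' → (∀ j → σ' (punchIn i j) ≡ ren (punchIn i') (σ j)) →
    (∀ y → τ' y ≡ ren (punchIn i') (τ y)) →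
    ∀ {b L u} → LinSub i b L u → LinSub i' (sub σ' τ' b) (subL σ τ L) (sub σ τ u)
  LinSub-sub eᵢ eσ eτ (hole refl) rewrite eᵢ = hole refl
  LinSub-sub {σ = σ} eᵢ eσ eτ (bound {j = j} refl) rewrite eσ j = LinSub-punchIn (λ _ → refl) (σ j)
  LinSub-sub {τ = τ} eᵢ eσ eτ (free {y}) rewrite eτ y = LinSub-punchIn (λ _ → refl) (τ y)
  LinSub-sub {i' = i'} {σ} {τ} {σ'} {τ'} eᵢ eσ eτ (lam {L = L} r) =
    lam (subst (λ K → LinSub (suc i') _ K _) (subL-liftS-wkL σ τ L) (LinSub-sub (cong wk eᵢ) eσ' eτ' r))
    where
    eσ' : ∀ j → liftS σ' (punchIn (suc _) j) ≡ ren (punchIn (suc i')) (liftS σ j)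
    eσ' zero    = refl
    eσ' (suc j) = ≡-trans (cong wk (eσ j)) (sym (ren-wk (λ _ → refl) (σ j)))
    eτ' : ∀ y → wk (τ' y) ≡ ren (punchIn (suc i')) (wk (τ y))
    eτ' y = ≡-trans (cong wk (eτ y)) (sym (ren-wk (λ _ → refl) (τ y)))
  LinSub-sub {σ = σ} {τ} eᵢ eσ eτ (app {L₁ = L₁} {L₂} p r rs) =
    app (subst (_ ↭_) (subL-++ σ τ L₁ L₂) (subL-↭ σ τ p)) (LinSub-sub eᵢ eσ eτ r) (LinSubs-sub eᵢ eσ eτ rs)

  LinSubs-sub : ∀ {m n} {i : Fin (suc m)} {i' : Fin (suc n)} {σ : Fin m → Tm n} {τ : ℕ → Tm n}
    {σ' : Fin (suc m) → Tm (suc n)} {τ' : ℕ → Tm (suc n)} →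
    σ' i ≡ bv i' → (∀ j → σ' (punchIn i j) ≡ ren (punchIn i') (σ j)) →
    (∀ y → τ' y ≡ ren (punchIn i') (τ y)) →
    ∀ {M L U} → LinSubs i M L U → LinSubs i' (subL σ' τ' M) (subL σ τ L) (subL σ τ U)
  LinSubs-sub eᵢ eσ eτ nil = nil
  LinSubs-sub {σ = σ} {τ} eᵢ eσ eτ (cons {L₁ = L₁} {L₂} p r rs) =
    cons (subst (_ ↭_) (subL-++ σ τ L₁ L₂) (subL-↭ σ τ p)) (LinSub-sub eᵢ eσ eτ r) (LinSubs-sub eᵢ eσ eτ rs)

sub-⟶ : ∀ {m n} (σ : Fin m → Tm n) (τ : ℕ → Tm n) {t u} → t ⟶ u → sub σ τ t ⟶ sub σ τ u
sub-⟶ σ τ (β⟶ r)    = β⟶ (LinSub-sub refl (λ _ → refl) (λ _ → refl) r)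
sub-⟶ σ τ (lam⟶ s)  = lam⟶ (sub-⟶ (liftS σ) (λ y → wk (τ y)) s)
sub-⟶ σ τ (appH⟶ s) = appH⟶ (sub-⟶ σ τ s)
sub-⟶ σ τ (appB⟶ {L₁ = L₁} {L₂} {u} {u'} s)
  rewrite subL-++ σ τ L₁ (u ∷ L₂) | subL-++ σ τ L₁ (u' ∷ L₂) = appB⟶ (sub-⟶ σ τ s)

sub-⟶* : ∀ {m n} (σ : Fin m → Tm n) (τ : ℕ → Tm n) {t u} → t ⟶* u → sub σ τ t ⟶* sub σ τ u
sub-⟶* σ τ = gmap (sub σ τ) (sub-⟶ σ τ)

ren-⟶* : ∀ {m n} (g : Fin m → Fin n) {t u} → t ⟶* u → ren g t ⟶* ren g u
ren-⟶* g {t} {u} rewrite ren≡sub {σ = bv ∘ g} {τ = fv} (λ _ → refl) (λ _ → refl) t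
                       | ren≡sub {σ = bv ∘ g} {τ = fv} (λ _ → refl) (λ _ → refl) u = sub-⟶* _ _

lam-⟶* : ∀ {n} {b b' : Tm (suc n)} → b ⟶* b' → lam b ⟶* lam b'
lam-⟶* = gmap lam lam⟶

appH-⟶* : ∀ {n} {t t' : Tm n} {L} → t ⟶* t' → app t L ⟶* app t' L
appH-⟶* = gmap _ appH⟶

appB-⟶* : ∀ {n} (t : Tm n) L₁ {L₂ u u'} → u ⟶* u' → app t (L₁ ++ u ∷ L₂) ⟶* app t (L₁ ++ u' ∷ L₂)
appB-⟶* t L₁ = gmap _ appB⟶

bag-⟶* : ∀ {n} (t : Tm n) L₁ {L L'} → Pointwise _⟶*_ L L' → app t (L₁ ++ L) ⟶* app t (L₁ ++ L')
bag-⟶* t L₁ [] = ε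
bag-⟶* t L₁ {u ∷ L} {u' ∷ L'} (s ∷ ss) =
  appB-⟶* t L₁ s ◅◅ subst₂ (λ K K' → app t K ⟶* app t K') (++-assoc L₁ (u' ∷ []) L) (++-assoc L₁ (u' ∷ []) L')
                         (bag-⟶* t (L₁ ++ u' ∷ []) ss)

app-⟶* : ∀ {n} {t t' : Tm n} {L L'} → t ⟶* t' → Pointwise _⟶*_ L L' → app t L ⟶* app t' L'
app-⟶* s ss = appH-⟶* s ◅◅ bag-⟶* _ [] ss

length-↭-++ : ∀ {A : Set} {L} (L₁ : List A) {L₂} → L ↭ L₁ ++ L₂ → length L ≡ length L₁ + length L₂
length-↭-++ L₁ p = ≡-trans (↭-length p) (length-++ L₁)

mutual
  LinSub-size : ∀ {n} {i : Fin (suc n)} {b L v} → LinSub i b L v → size v + length L ≡ size b + sizeL L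
  LinSub-size (hole {s = s} refl) = ≡-trans (+-comm (size s) 1) (cong suc (sym (+-identityʳ (size s))))
  LinSub-size (bound _) = refl
  LinSub-size free = refl
  LinSub-size (lam {b = b} {L} {b'} r) = begin
    suc (size b' + length L)         ≡⟨ cong (λ k → suc (size b' + k)) (sym (renL-length suc L)) ⟩
    suc (size b' + length (wkL L))   ≡⟨ cong suc (LinSub-size r) ⟩
    suc (size b + sizeL (wkL L))     ≡⟨ cong (λ k → suc (size b + k)) (sizeL-renL suc L) ⟩
    suc (size b + sizeL L)           ∎
    where open ≡-Reasoning
  LinSub-size (app {t = t} {M} {L} {L₁} {L₂} {t'} {M'} p r rs) = begin
    suc (size t' + sizeL M') + length L
      ≡⟨ cong (suc (size t' + sizeL M') +_) (length-↭-++ L₁ p) ⟩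
    suc (size t' + sizeL M') + (length L₁ + length L₂)
      ≡⟨ interchange (size t') _ _ _ ⟩
    suc ((size t' + length L₁) + (sizeL M' + length L₂))
      ≡⟨ cong₂ (λ a b → suc (a + b)) (LinSub-size r) (LinSubs-size rs) ⟩
    suc ((size t + sizeL L₁) + (sizeL M + sizeL L₂))
      ≡⟨ sym (interchange (size t) _ _ _) ⟩
    suc (size t + sizeL M) + (sizeL L₁ + sizeL L₂)
      ≡⟨ cong (suc (size t + sizeL M) +_) (sym (sizeL-↭-++ L₁ p)) ⟩
    suc (size t + sizeL M) + sizeL L ∎
    where
    open ≡-Reasoning
    interchange : ∀ a b c d → suc (a + b) + (c + d) ≡ suc ((a + c) + (b + d))
    interchange = solve-∀

  LinSubs-size : ∀ {n} {i : Fin (suc n)} {M L V} → LinSubs i M L V → sizeL V + length L ≡ sizeL M + sizeL L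
  LinSubs-size nil = refl
  LinSubs-size (cons {m = m} {M} {L} {L₁} {L₂} {m'} {M'} p r rs) = begin
    (size m' + sizeL M') + length L
      ≡⟨ cong ((size m' + sizeL M') +_) (length-↭-++ L₁ p) ⟩
    (size m' + sizeL M') + (length L₁ + length L₂)
      ≡⟨ interchange (size m') _ _ _ ⟩
    (size m' + length L₁) + (sizeL M' + length L₂)
      ≡⟨ cong₂ _+_ (LinSub-size r) (LinSubs-size rs) ⟩
    (size m + sizeL L₁) + (sizeL M + sizeL L₂)
      ≡⟨ interchange (size m) _ _ _ ⟩
    (size m + sizeL M) + (sizeL L₁ + sizeL L₂)
      ≡⟨ cong ((size m + sizeL M) +_) (sym (sizeL-↭-++ L₁ p)) ⟩
    (size m + sizeL M) + sizeL L ∎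
    where
    open ≡-Reasoning
    interchange : ∀ a b c d → (a + b) + (c + d) ≡ (a + c) + (b + d)
    interchange = solve-∀

mutual
  sizeL≤LinSub : ∀ {n} {i : Fin (suc n)} {b L v} → LinSub i b L v → sizeL L ≤ size v
  sizeL≤LinSub (hole {s = s} _) = ≤-reflexive (+-identityʳ (size s))
  sizeL≤LinSub (bound _) = z≤n
  sizeL≤LinSub free = z≤n
  sizeL≤LinSub (lam {L = L} r) = ≤-trans (≤-reflexive (sym (sizeL-renL suc L))) (≤-trans (sizeL≤LinSub r) (n≤1+n _))
  sizeL≤LinSub (app {L₁ = L₁} p r rs) =
    ≤-trans (≤-reflexive (sizeL-↭-++ L₁ p)) (≤-trans (+-mono-≤ (sizeL≤LinSub r) (sizeL≤LinSubs rs)) (n≤1+n _))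

  sizeL≤LinSubs : ∀ {n} {i : Fin (suc n)} {M L V} → LinSubs i M L V → sizeL L ≤ sizeL V
  sizeL≤LinSubs nil = z≤n
  sizeL≤LinSubs (cons {L₁ = L₁} p r rs) = ≤-trans (≤-reflexive (sizeL-↭-++ L₁ p)) (+-mono-≤ (sizeL≤LinSub r) (sizeL≤LinSubs rs))

++-interchange-↭ : ∀ {A : Set} (a b c d : List A) → (a ++ b) ++ (c ++ d) ↭ (a ++ c) ++ (b ++ d)
++-interchange-↭ a b c d =
  ↭-trans (↭-reflexive (++-assoc a b (c ++ d))) (↭-trans (++⁺ˡ a (shifts b c)) (↭-reflexive (sym (++-assoc a c (b ++ d)))))

LinSub-resp-↭ : ∀ {n} {i : Fin (suc n)} {b L v L'} → LinSub i b L v → L ↭ L' → LinSub i b L' v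
LinSub-resp-↭ (hole e) q with ↭-singleton-inv (↭-sym q)
... | refl = hole e
LinSub-resp-↭ (bound e) q with ↭-empty-inv (↭-sym q)
... | refl = bound e
LinSub-resp-↭ free q with ↭-empty-inv (↭-sym q)
... | refl = free
LinSub-resp-↭ (lam r) q = lam (LinSub-resp-↭ r (renL-↭ suc q))
LinSub-resp-↭ (app p r rs) q = app (↭-trans (↭-sym q) p) r rs

LinSubs-resp-↭ : ∀ {n} {i : Fin (suc n)} {M L V L'} → LinSubs i M L V → L ↭ L' → LinSubs i M L' V
LinSubs-resp-↭ nil q with ↭-empty-inv (↭-sym q)
... | refl = nil
LinSubs-resp-↭ (cons p r rs) q = cons (↭-trans (↭-sym q) p) r rs

LinSubs-++⁺ : ∀ {n} {i : Fin (suc n)} {A B La Lb Ra Rb} →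
  LinSubs i A La Ra → LinSubs i B Lb Rb → LinSubs i (A ++ B) (La ++ Lb) (Ra ++ Rb)
LinSubs-++⁺ nil rs = rs
LinSubs-++⁺ {Lb = Lb} (cons {L₁ = L₁} {L₂} p r rs) rs' =
  cons (↭-trans (++⁺ʳ Lb p) (↭-reflexive (++-assoc L₁ L₂ Lb))) r (LinSubs-++⁺ rs rs')

LinSubs-++⁻ : ∀ {n} {i : Fin (suc n)} A {B L R} → LinSubs i (A ++ B) L R →
  ∃₂ λ La Lb → ∃₂ λ Ra Rb → L ↭ La ++ Lb × LinSubs i A La Ra × LinSubs i B Lb Rb × R ≡ Ra ++ Rb
LinSubs-++⁻ [] rs = [] , _ , [] , _ , refl , nil , rs , refl
LinSubs-++⁻ (a ∷ A) (cons {L₁ = L₁} p r rs) with LinSubs-++⁻ A rs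
... | La , Lb , Ra , Rb , q , rsa , rsb , refl =
  L₁ ++ La , Lb , _ ∷ Ra , Rb , ↭-trans p (↭-trans (++⁺ˡ L₁ q) (↭-reflexive (sym (++-assoc L₁ La Lb)))) ,
  cons refl r rsa , rsb , refl

LinSubs-↭-terms : ∀ {n} {i : Fin (suc n)} {M M' L V} → LinSubs i M L V → M ↭ M' →
  ∃ λ V' → LinSubs i M' L V' × V ↭ V'
LinSubs-↭-terms rs refl = _ , rs , refl
LinSubs-↭-terms (cons p r rs) (prep _ q) with LinSubs-↭-terms rs q
... | _ , rs' , q' = _ , cons p r rs' , prep _ q'
LinSubs-↭-terms (cons {L₁ = La} p r (cons {L₁ = Lb} {Lc} p' r' rs)) (swap _ _ q) with LinSubs-↭-terms rs q
... | _ , rs' , q' = _ , cons (↭-trans p (↭-trans (++⁺ˡ La p') (shifts La Lb))) r' (cons refl r rs') , swap _ _ q'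
LinSubs-↭-terms rs (trans q₁ q₂) with LinSubs-↭-terms rs q₁
... | _ , rs₁ , q₁' with LinSubs-↭-terms rs₁ q₂
... | _ , rs₂ , q₂' = _ , rs₂ , ↭-trans q₁' q₂'

module LinSub-bag-congruence (R : ∀ {n} → Tm n → Tm n → Set)
  (R-refl : ∀ {n} (t : Tm n) → R t t)
  (R-ren : ∀ {m n} (g : Fin m → Fin n) {t u} → R t u → R (ren g t) (ren g u))
  (R-lam : ∀ {n} {b b' : Tm (suc n)} → R b b' → R (lam b) (lam b'))
  (R-app : ∀ {n} {t t' : Tm n} {L L'} → R t t' → Pointwise R L L' → R (app t L) (app t' L')) where

  Pointwise-renL : ∀ {m n} (g : Fin m → Fin n) {L L'} → Pointwise R L L' → Pointwise R (renL g L) (renL g L')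
  Pointwise-renL g []       = []
  Pointwise-renL g (r ∷ rs) = R-ren g r ∷ Pointwise-renL g rs

  mutual
    LinSub-bag : ∀ {n} {i : Fin (suc n)} {b L v L'} → LinSub i b L v → Pointwise R L' L →
      ∃ λ v' → LinSub i b L' v' × R v' v
    LinSub-bag (hole e) (r ∷ []) = _ , hole e , r
    LinSub-bag (bound e) [] = _ , bound e , R-refl _
    LinSub-bag free [] = _ , free , R-refl _
    LinSub-bag (lam r) rs with LinSub-bag r (Pointwise-renL suc rs)
    ... | _ , r' , q = _ , lam r' , R-lam q
    LinSub-bag (app {L₁ = L₁} p r rs) qs with Pointwise-↭-commute qs p
    ... | _ , p' , qs' with Pointwise-++⁻ʳ L₁ qs'
    ... | _ , _ , refl , qs₁ , qs₂ with LinSub-bag r qs₁ | LinSubs-bag rs qs₂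
    ... | _ , r' , q₁ | _ , rs' , q₂ = _ , app p' r' rs' , R-app q₁ q₂

    LinSubs-bag : ∀ {n} {i : Fin (suc n)} {M L V L'} → LinSubs i M L V → Pointwise R L' L →
      ∃ λ V' → LinSubs i M L' V' × Pointwise R V' V
    LinSubs-bag nil [] = _ , nil , []
    LinSubs-bag (cons {L₁ = L₁} p r rs) qs with Pointwise-↭-commute qs p
    ... | _ , p' , qs' with Pointwise-++⁻ʳ L₁ qs'
    ... | _ , _ , refl , qs₁ , qs₂ with LinSub-bag r qs₁ | LinSubs-bag rs qs₂
    ... | _ , r' , q₁ | _ , rs' , q₂ = _ , cons p' r' rs' , q₁ ∷ q₂

open LinSub-bag-congruence _⟶*_ (λ _ → ε) ren-⟶* lam-⟶* app-⟶*
  renaming (LinSub-bag to LinSub-bag-⟶*) using ()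
open LinSub-bag-congruence _≈_ ≈-refl ren-≈ lam≈ (λ p q → app≈ p (bag≈ (Pointwise⇒≈ᴾ q) refl))
  renaming (LinSub-bag to LinSub-bag-≈) using ()

mutual
  LinSub-≈-term : ∀ {n} {i : Fin (suc n)} {b b' L v} → LinSub i b L v → b ≈ b' →
    ∃ λ v' → LinSub i b' L v' × v ≈ v'
  LinSub-≈-term (hole e) bv≈ = _ , hole e , ≈-refl _
  LinSub-≈-term (bound e) bv≈ = _ , bound e , ≈-refl _
  LinSub-≈-term free fv≈ = _ , free , ≈-refl _
  LinSub-≈-term (lam r) (lam≈ p) with LinSub-≈-term r p
  ... | _ , r' , q = _ , lam r' , lam≈ q
  LinSub-≈-term (app x r rs) (app≈ p (bag≈ q q')) with LinSub-≈-term r p | LinSubs-≈-terms rs q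
  ... | _ , r₁ , e₁ | _ , rs₁ , e₂ with LinSubs-↭-terms rs₁ q'
  ... | _ , rs₂ , e₃ = _ , app x r₁ rs₂ , app≈ e₁ (bag≈ e₂ e₃)

  LinSubs-≈-terms : ∀ {n} {i : Fin (suc n)} {M M' L V} → LinSubs i M L V → M ≈ᴾ M' →
    ∃ λ V' → LinSubs i M' L V' × V ≈ᴾ V'
  LinSubs-≈-terms nil []≈ = _ , nil , []≈
  LinSubs-≈-terms (cons x r rs) (∷≈ p ps) with LinSub-≈-term r p | LinSubs-≈-terms rs ps
  ... | _ , r₁ , e₁ | _ , rs₁ , e₂ = _ , cons x r₁ rs₁ , ∷≈ e₁ e₂

LinSub-≈ : ∀ {n} {i : Fin (suc n)} {b b' L L' v} → LinSub i b L v → b ≈ b' → L' ≈ᴮ L →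
  ∃ λ v' → LinSub i b' L' v' × v' ≈ v
LinSub-≈ r p (bag≈ q q') with LinSub-≈-term r p
... | _ , r₁ , e₁ with LinSub-bag-≈ (LinSub-resp-↭ r₁ (↭-sym q')) (≈ᴾ⇒Pointwise q)
... | v' , r₂ , e₂ = v' , r₂ , ≈-trans e₂ (≈-sym e₁)

punchIn-punchIn-comm : ∀ {n} (p : Fin (suc (suc n))) (q p' : Fin (suc n)) → punchIn (punchIn p q) p' ≡ p →
  ∀ j → punchIn (punchIn p q) (punchIn p' j) ≡ punchIn p (punchIn q j)
punchIn-punchIn-comm zero q zero e j = refl
punchIn-punchIn-comm (suc p) zero p' refl j = refl
punchIn-punchIn-comm (suc p) (suc q) (suc p') e zero = refl
punchIn-punchIn-comm (suc p) (suc q) (suc p') e (suc j) = cong suc (punchIn-punchIn-comm p q p' (suc-injective e) j)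

renL-↭-++⁻ : ∀ {m n} (g : Fin m → Fin n) M L₁ L₂ → renL g M ↭ L₁ ++ L₂ →
  ∃₂ λ M₁ M₂ → M ↭ M₁ ++ M₂ × L₁ ≡ renL g M₁ × L₂ ≡ renL g M₂
renL-↭-++⁻ g M L₁ L₂ p with ↭-map-inv (ren g) (subst (_↭ L₁ ++ L₂) (renL≡map g M) p)
... | M' , eq , q with map-≡-++⁻ (ren g) M' L₁ (sym eq)
... | M₁ , M₂ , refl , e₁ , e₂ = M₁ , M₂ , q , ≡-trans e₁ (sym (renL≡map g M₁)) , ≡-trans e₂ (sym (renL≡map g M₂))

mutual
  LinSub-ren⁻ : ∀ {m n} {i : Fin (suc m)} {i' : Fin (suc n)} {g : Fin m → Fin n} {g' : Fin (suc m) → Fin (suc n)} →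
    g' i ≡ i' → (∀ j → g' (punchIn i j) ≡ punchIn i' (g j)) →
    ∀ b M {v} → LinSub i' (ren g' b) (renL g M) v → ∃ λ v₀ → LinSub i b M v₀ × v ≡ ren g v₀
  LinSub-ren⁻ {i = i} {i'} {g} {g'} eᵢ eg (bv k) [] (bound {j = j} e) with k ≟ i
  ... | yes refl = ⊥-elim (punchInᵢ≢i i' j (≡-trans e eᵢ))
  ... | no k≢i = bv j₀ , bound (punchIn-punchOut (k≢i ∘ sym)) ,
          cong bv (punchIn-injective i' j (g j₀) (≡-trans e (≡-trans (cong g' (sym (punchIn-punchOut (k≢i ∘ sym)))) (eg j₀))))
    where j₀ = punchOut (k≢i ∘ sym)
  LinSub-ren⁻ {i = i} {i'} {g} {g'} eᵢ eg (bv k) (s ∷ []) (hole e) with k ≟ i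
  ... | yes refl = s , hole refl , refl
  ... | no k≢i = ⊥-elim (punchInᵢ≢i i' (g j₀) (≡-trans (sym (eg j₀)) (≡-trans (cong g' (punchIn-punchOut (k≢i ∘ sym))) e)))
    where j₀ = punchOut (k≢i ∘ sym)
  LinSub-ren⁻ eᵢ eg (fv y) [] free = _ , free , refl
  LinSub-ren⁻ {g = g} {g'} eᵢ eg (lam d) M (lam r)
    with LinSub-ren⁻ (cong suc eᵢ) eg' d (wkL M) (subst (λ K → LinSub _ (ren (liftR g') d) K _) (sym (renL-wkL (λ _ → refl) M)) r)
    where
    eg' : ∀ j → liftR g' (punchIn (suc _) j) ≡ punchIn (suc _) (liftR g j)
    eg' zero    = refl
    eg' (suc j) = cong suc (eg j)
  ... | d₀ , r' , refl = lam d₀ , lam r' , refl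
  LinSub-ren⁻ {g = g} eᵢ eg (app t K) M (app {L₁ = L₁} {L₂} p r rs) with renL-↭-++⁻ g M L₁ L₂ p
  ... | M₁ , M₂ , q , refl , refl with LinSub-ren⁻ eᵢ eg t M₁ r | LinSubs-ren⁻ eᵢ eg K M₂ rs
  ... | t₀ , r' , refl | K₀ , rs' , refl = app t₀ K₀ , app q r' rs' , refl

  LinSubs-ren⁻ : ∀ {m n} {i : Fin (suc m)} {i' : Fin (suc n)} {g : Fin m → Fin n} {g' : Fin (suc m) → Fin (suc n)} →
    g' i ≡ i' → (∀ j → g' (punchIn i j) ≡ punchIn i' (g j)) →
    ∀ K M {V} → LinSubs i' (renL g' K) (renL g M) V → ∃ λ V₀ → LinSubs i K M V₀ × V ≡ renL g V₀
  LinSubs-ren⁻ eᵢ eg [] [] nil = [] , nil , refl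
  LinSubs-ren⁻ {g = g} eᵢ eg (k ∷ K) M (cons {L₁ = L₁} {L₂} p r rs) with renL-↭-++⁻ g M L₁ L₂ p
  ... | M₁ , M₂ , q , refl , refl with LinSub-ren⁻ eᵢ eg k M₁ r | LinSubs-ren⁻ eᵢ eg K M₂ rs
  ... | k₀ , r' , refl | K₀ , rs' , refl = k₀ ∷ K₀ , cons q r' rs' , refl

-- The substitution lemma: substituting M into c[K/p] distributes M between c and K.
mutual
  LinSub-compose : ∀ {n} {p : Fin (suc (suc n))} {q p' : Fin (suc n)} → punchIn (punchIn p q) p' ≡ p →
    ∀ {c K b M v} → LinSub p c K b → LinSub q b M v →
    ∃₂ λ M₁ M₂ → ∃₂ λ c₁ K₁ → M ↭ M₁ ++ M₂ × LinSub (punchIn p q) c (renL (punchIn p') M₁) c₁ ×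
      LinSubs q K M₂ K₁ × LinSub p' c₁ K₁ v
  LinSub-compose e {M = M} (hole refl) r =
    [] , M , _ , _ ∷ [] , refl , bound e , cons (↭-sym (++-identityʳ M)) r nil , hole refl
  LinSub-compose {p = p} {q} {p'} e (bound refl) (hole {s = s} e') =
    s ∷ [] , [] , ren (punchIn p') s , [] , refl , hole (cong (punchIn p) e') , nil , LinSub-punchIn (λ _ → refl) s
  LinSub-compose {p = p} {q} {p'} e (bound refl) (bound {j = j} refl) =
    [] , [] , bv (punchIn p' j) , [] , refl , bound (punchIn-punchIn-comm p q p' e j) , nil , bound refl
  LinSub-compose e free free = [] , [] , _ , [] , refl , free , nil , free
  LinSub-compose {q = q} e {lam d} {K} {M = M} (lam r) (lam r') with LinSub-compose (cong suc e) r r'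
  ... | M₁' , M₂' , c₁ , K₁' , pm , r₁ , rs₁ , r₂ with renL-↭-++⁻ suc M M₁' M₂' pm
  ... | M₁ , M₂ , pm' , refl , refl with LinSubs-ren⁻ {i = q} {g = suc} {g' = suc} refl (λ _ → refl) K M₂ rs₁
  ... | K₁ , rs₁' , refl =
    M₁ , M₂ , lam c₁ , K₁ , pm' ,
    lam (subst (λ L → LinSub _ d L c₁) (renL-wkL (λ _ → refl) M₁) r₁) , rs₁' , lam r₂
  LinSub-compose {p' = p'} e (app pK r rs) (app {L₁ = Ma} {Mb} pM r' rs')
    with LinSub-compose e r r' | LinSubs-compose e rs rs'
  ... | Ma₁ , Ma₂ , c₁ , Ka₁ , pa , ra₁ , rsa , ra₂ | Mb₁ , Mb₂ , C₁ , Kb₁ , pb , rsb₁ , rsb , rsb₂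
    with LinSubs-↭-terms (LinSubs-++⁺ rsa rsb) (↭-sym pK)
  ... | K₁ , rsK , pK₁ =
    Ma₁ ++ Mb₁ , Ma₂ ++ Mb₂ , app c₁ C₁ , K₁ ,
    ↭-trans pM (↭-trans (++⁺ pa pb) (++-interchange-↭ Ma₁ Ma₂ Mb₁ Mb₂)) ,
    app (↭-reflexive (renL-++ (punchIn p') Ma₁ Mb₁)) ra₁ rsb₁ , rsK , app (↭-sym pK₁) ra₂ rsb₂

  LinSubs-compose : ∀ {n} {p : Fin (suc (suc n))} {q p' : Fin (suc n)} → punchIn (punchIn p q) p' ≡ p →
    ∀ {C K B M V} → LinSubs p C K B → LinSubs q B M V →
    ∃₂ λ M₁ M₂ → ∃₂ λ C₁ K₁ → M ↭ M₁ ++ M₂ × LinSubs (punchIn p q) C (renL (punchIn p') M₁) C₁ ×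
      LinSubs q K M₂ K₁ × LinSubs p' C₁ K₁ V
  LinSubs-compose e nil nil = [] , [] , [] , [] , refl , nil , nil , nil
  LinSubs-compose {p' = p'} e (cons pK r rs) (cons {L₁ = Ma} {Mb} pM r' rs')
    with LinSub-compose e r r' | LinSubs-compose e rs rs'
  ... | Ma₁ , Ma₂ , c₁ , Ka₁ , pa , ra₁ , rsa , ra₂ | Mb₁ , Mb₂ , C₁ , Kb₁ , pb , rsb₁ , rsb , rsb₂
    with LinSubs-↭-terms (LinSubs-++⁺ rsa rsb) (↭-sym pK)
  ... | K₁ , rsK , pK₁ =
    Ma₁ ++ Mb₁ , Ma₂ ++ Mb₂ , c₁ ∷ C₁ , K₁ ,
    ↭-trans pM (↭-trans (++⁺ pa pb) (++-interchange-↭ Ma₁ Ma₂ Mb₁ Mb₂)) ,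
    cons (↭-reflexive (renL-++ (punchIn p') Ma₁ Mb₁)) ra₁ rsb₁ , rsK , cons (↭-sym pK₁) ra₂ rsb₂

LinSub-⟶-postpone : ∀ {n} {i : Fin (suc n)} {b b' M v} → b ⟶ b' → LinSub i b' M v →
  ∃ λ v₁ → LinSub i b M v₁ × v₁ ⟶ v
LinSub-⟶-postpone {i = i} (β⟶ r) r' with LinSub-compose {p = zero} {i} {zero} refl r r'
... | _ , _ , c₁ , K₁ , pm , r₁ , rs₁ , r₂ = app (lam c₁) K₁ , app pm (lam r₁) rs₁ , β⟶ r₂
LinSub-⟶-postpone (lam⟶ s) (lam r) with LinSub-⟶-postpone s r
... | _ , r' , s' = _ , lam r' , lam⟶ s'
LinSub-⟶-postpone (appH⟶ s) (app p r rs) with LinSub-⟶-postpone s r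
... | _ , r' , s' = _ , app p r' rs , appH⟶ s'
LinSub-⟶-postpone (appB⟶ {L₁ = K₁} s) (app p r rs) with LinSubs-++⁻ K₁ rs
... | _ , _ , Ra , _ , q , rsa , cons q' ru rK , refl with LinSub-⟶-postpone s ru
... | w₁ , ru' , s' = app _ (Ra ++ w₁ ∷ _) , app p r (LinSubs-resp-↭ (LinSubs-++⁺ rsa (cons q' ru' rK)) (↭-sym q)) , appB⟶ s'

LinSub-⟶*-postpone : ∀ {n} {i : Fin (suc n)} {b b' M v} → b ⟶* b' → LinSub i b' M v →
  ∃ λ v₁ → LinSub i b M v₁ × v₁ ⟶* v
LinSub-⟶*-postpone ε r = _ , r , ε
LinSub-⟶*-postpone (s ◅ ss) r with LinSub-⟶*-postpone ss r
... | _ , r₂ , ss' with LinSub-⟶-postpone s r₂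
... | v₁ , r₁ , s' = v₁ , r₁ , s' ◅ ss'

mutual
  LinSub-Occ⁻ : ∀ {z n} {i : Fin (suc n)} {b L v} → LinSub i b L v → Occ z v → Occ z b ⊎ Any (Occ z) L
  LinSub-Occ⁻ (hole e) o = inj₂ (here o)
  LinSub-Occ⁻ free here = inj₁ here
  LinSub-Occ⁻ (lam {L = L} r) (lam o) = Sum.map lam (OccL-renL⁻ suc L) (LinSub-Occ⁻ r o)
  LinSub-Occ⁻ (app p r rs) (appH o) = Sum.map appH (Any-resp-↭ (↭-sym p) ∘ Any.++⁺ˡ) (LinSub-Occ⁻ r o)
  LinSub-Occ⁻ (app {L₁ = L₁} p r rs) (appB o) =
    Sum.map appB (Any-resp-↭ (↭-sym p) ∘ Any.++⁺ʳ L₁) (LinSubs-Occ⁻ rs o)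

  LinSubs-Occ⁻ : ∀ {z n} {i : Fin (suc n)} {M L V} → LinSubs i M L V → Any (Occ z) V → Any (Occ z) M ⊎ Any (Occ z) L
  LinSubs-Occ⁻ (cons p r rs) (here o) = Sum.map here (Any-resp-↭ (↭-sym p) ∘ Any.++⁺ˡ) (LinSub-Occ⁻ r o)
  LinSubs-Occ⁻ (cons {L₁ = L₁} p r rs) (there o) =
    Sum.map there (Any-resp-↭ (↭-sym p) ∘ Any.++⁺ʳ L₁) (LinSubs-Occ⁻ rs o)

mutual
  LinSub-Occ-term⁺ : ∀ {z n} {i : Fin (suc n)} {b L v} → LinSub i b L v → Occ z b → Occ z v
  LinSub-Occ-term⁺ free here = here
  LinSub-Occ-term⁺ (lam r) (lam o) = lam (LinSub-Occ-term⁺ r o)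
  LinSub-Occ-term⁺ (app p r rs) (appH o) = appH (LinSub-Occ-term⁺ r o)
  LinSub-Occ-term⁺ (app p r rs) (appB o) = appB (LinSubs-Occ-term⁺ rs o)

  LinSubs-Occ-term⁺ : ∀ {z n} {i : Fin (suc n)} {M L V} → LinSubs i M L V → Any (Occ z) M → Any (Occ z) V
  LinSubs-Occ-term⁺ (cons p r rs) (here o)  = here (LinSub-Occ-term⁺ r o)
  LinSubs-Occ-term⁺ (cons p r rs) (there o) = there (LinSubs-Occ-term⁺ rs o)

mutual
  LinSub-Occ-bag⁺ : ∀ {z n} {i : Fin (suc n)} {b L v} → LinSub i b L v → Any (Occ z) L → Occ z v
  LinSub-Occ-bag⁺ (hole e) (here o) = o
  LinSub-Occ-bag⁺ (lam r) o = lam (LinSub-Occ-bag⁺ r (OccL-renL⁺ suc o))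
  LinSub-Occ-bag⁺ (app {L₁ = L₁} p r rs) o with Any.++⁻ L₁ (Any-resp-↭ p o)
  ... | inj₁ o' = appH (LinSub-Occ-bag⁺ r o')
  ... | inj₂ o' = appB (LinSubs-Occ-bag⁺ rs o')

  LinSubs-Occ-bag⁺ : ∀ {z n} {i : Fin (suc n)} {M L V} → LinSubs i M L V → Any (Occ z) L → Any (Occ z) V
  LinSubs-Occ-bag⁺ (cons {L₁ = L₁} p r rs) o with Any.++⁻ L₁ (Any-resp-↭ p o)
  ... | inj₁ o' = here (LinSub-Occ-bag⁺ r o')
  ... | inj₂ o' = there (LinSubs-Occ-bag⁺ rs o')

⟶-Occ⁻ : ∀ {z n} {t u : Tm n} → t ⟶ u → Occ z u → Occ z t
⟶-Occ⁻ (β⟶ r) o = [ appH ∘ lam , appB ]′ (LinSub-Occ⁻ r o)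
⟶-Occ⁻ (lam⟶ s) (lam o) = lam (⟶-Occ⁻ s o)
⟶-Occ⁻ (appH⟶ s) (appH o) = appH (⟶-Occ⁻ s o)
⟶-Occ⁻ (appH⟶ s) (appB o) = appB o
⟶-Occ⁻ (appB⟶ s) (appH o) = appH o
⟶-Occ⁻ (appB⟶ {L₁ = L₁} s) (appB o) with Any.++⁻ L₁ o
... | inj₁ o' = appB (Any.++⁺ˡ o')
... | inj₂ (here o') = appB (Any.++⁺ʳ L₁ (here (⟶-Occ⁻ s o')))
... | inj₂ (there o') = appB (Any.++⁺ʳ L₁ (there o'))

⟶-size : ∀ {n} {t u : Tm n} → t ⟶ u → size u ≤ size t
⟶-size (β⟶ {b = b} {L} {u} r) = begin
  size u                     ≤⟨ m≤m+n (size u) (length L) ⟩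
  size u + length L          ≡⟨ LinSub-size r ⟩
  size b + sizeL L           ≤⟨ n≤1+n _ ⟩
  suc (size b + sizeL L)     ≤⟨ n≤1+n _ ⟩
  size (app (lam b) L)       ∎
  where open ≤-Reasoning
⟶-size (lam⟶ s)  = s≤s (⟶-size s)
⟶-size (appH⟶ s) = s≤s (+-monoˡ-≤ _ (⟶-size s))
⟶-size (appB⟶ {t = t} {L₁} {L₂} {u} {u'} s) rewrite sizeL-++ L₁ (u ∷ L₂) | sizeL-++ L₁ (u' ∷ L₂) =
  s≤s (+-monoʳ-≤ (size t) (+-monoʳ-≤ (sizeL L₁) (+-monoˡ-≤ (sizeL L₂) (⟶-size s))))

⟶*⇒≽ : ∀ {n} {t u : Tm n} → t ⟶* u → u ≼ t
⟶*⇒≽ ε = ≼-refl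
⟶*⇒≽ (s ◅ ss) = ≼-trans (⟶*⇒≽ ss) (⟶-size s , ⟶-Occ⁻ s)

≡ᵇ-true : ∀ y x → (y ≡ᵇ x) ≡ true → y ≡ x
≡ᵇ-true y x eq = ≡ᵇ⇒≡ y x (subst T (sym eq) tt)

≡ᵇ-false : ∀ y x → (y ≡ᵇ x) ≡ false → y ≢ x
≡ᵇ-false y x eq y≡x = subst T eq (≡⇒≡ᵇ y x y≡x)

Opens : ∀ {n} → ℕ → Fin (suc n) → (Fin (suc n) → Tm n) → (ℕ → Tm n) → Set
Opens x i σ τ = σ i ≡ fv x × (∀ j → σ (punchIn i j) ≡ bv j) × (∀ y → τ y ≡ fv y)

Opens-lift : ∀ {n x} {i : Fin (suc n)} {σ τ} → Opens x i σ τ → Opens x (suc i) (liftS σ) (λ y → wk (τ y))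
Opens-lift {σ = σ} (eᵢ , eσ , eτ) = cong wk eᵢ , eσ' , λ y → cong wk (eτ y)
  where
  eσ' : ∀ j → liftS σ (punchIn (suc _) j) ≡ bv j
  eσ' zero    = refl
  eσ' (suc j) = cong wk (eσ j)

mutual
  Rep-open⇒LinSub : ∀ {x n} {i : Fin (suc n)} {σ τ} → Opens x i σ τ →
    ∀ b {L u} → ¬ Occ x b → Rep x (sub σ τ b) L u → LinSub i b L u
  Rep-open⇒LinSub {x} {i = i} (eᵢ , eσ , eτ) (bv k) x∉b d with k ≟ i
  ... | yes refl with subst (λ w → Rep x w _ _) eᵢ d
  ...   | rx = hole refl
  ...   | ry x≢x = ⊥-elim (x≢x refl)
  Rep-open⇒LinSub {x} {σ = σ} (eᵢ , eσ , eτ) (bv k) x∉b d | no k≢i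
    with subst (λ w → Rep x w _ _) (≡-trans (cong σ (sym (punchIn-punchOut (k≢i ∘ sym)))) (eσ _)) d
  ... | rb = bound (punchIn-punchOut (k≢i ∘ sym))
  Rep-open⇒LinSub {x} (eᵢ , eσ , eτ) (fv y) x∉b d with subst (λ w → Rep x w _ _) (eτ y) d
  ... | rx = ⊥-elim (x∉b here)
  ... | ry _ = free
  Rep-open⇒LinSub op (lam c) x∉b (rlam r) = lam (Rep-open⇒LinSub (Opens-lift op) c (x∉b ∘ lam) r)
  Rep-open⇒LinSub op (app t M) x∉b (rapp p r rs) =
    app p (Rep-open⇒LinSub op t (x∉b ∘ appH) r) (Reps-open⇒LinSubs op M (x∉b ∘ appB) rs)

  Reps-open⇒LinSubs : ∀ {x n} {i : Fin (suc n)} {σ τ} → Opens x i σ τ →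
    ∀ M {L U} → ¬ Any (Occ x) M → RepL x (subL σ τ M) L U → LinSubs i M L U
  Reps-open⇒LinSubs op [] x∉M []r = nil
  Reps-open⇒LinSubs op (m ∷ M) x∉M (∷r p r rs) =
    cons p (Rep-open⇒LinSub op m (x∉M ∘ here) r) (Reps-open⇒LinSubs op M (x∉M ∘ there) rs)

mutual
  LinSub⇒Rep-open : ∀ {x n} {i : Fin (suc n)} {σ τ} → Opens x i σ τ →
    ∀ {b L u} → ¬ Occ x b → LinSub i b L u → Rep x (sub σ τ b) L u
  LinSub⇒Rep-open {x} (eᵢ , eσ , eτ) x∉b (hole refl) = subst (λ w → Rep x w _ _) (sym eᵢ) rx
  LinSub⇒Rep-open {x} (eᵢ , eσ , eτ) x∉b (bound refl) = subst (λ w → Rep x w _ _) (sym (eσ _)) rb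
  LinSub⇒Rep-open {x} (eᵢ , eσ , eτ) x∉b (free {y}) =
    subst (λ w → Rep x w _ _) (sym (eτ y)) (ry λ { refl → x∉b here })
  LinSub⇒Rep-open op x∉b (lam r) = rlam (LinSub⇒Rep-open (Opens-lift op) (x∉b ∘ lam) r)
  LinSub⇒Rep-open op x∉b (app p r rs) =
    rapp p (LinSub⇒Rep-open op (x∉b ∘ appH) r) (LinSubs⇒Reps-open op (x∉b ∘ appB) rs)

  LinSubs⇒Reps-open : ∀ {x n} {i : Fin (suc n)} {σ τ} → Opens x i σ τ →
    ∀ {M L U} → ¬ Any (Occ x) M → LinSubs i M L U → RepL x (subL σ τ M) L U
  LinSubs⇒Reps-open op x∉M nil = []r
  LinSubs⇒Reps-open op x∉M (cons p r rs) =
    ∷r p (LinSub⇒Rep-open op (x∉M ∘ here) r) (LinSubs⇒Reps-open op (x∉M ∘ there) rs)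

closeVar : ∀ {n} → ℕ → Fin (suc n) → ℕ → Tm (suc n)
closeVar x i y = if y ≡ᵇ x then bv i else fv y

wk-closeVar : ∀ {n} x (i : Fin (suc n)) y → wk (closeVar x i y) ≡ closeVar x (suc i) y
wk-closeVar x i y with y ≡ᵇ x
... | true  = refl
... | false = refl

Closes : ∀ {n} → ℕ → Fin (suc n) → (Fin n → Tm (suc n)) → (ℕ → Tm (suc n)) → Set
Closes x i σ τ = (∀ j → σ j ≡ bv (punchIn i j)) × (∀ y → τ y ≡ closeVar x i y)

Closes-lift : ∀ {n x} {i : Fin (suc n)} {σ τ} → Closes x i σ τ → Closes x (suc i) (liftS σ) (λ y → wk (τ y))
Closes-lift {x = x} {i} {σ} (eσ , eτ) = eσ' , λ y → ≡-trans (cong wk (eτ y)) (wk-closeVar x i y)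
  where
  eσ' : ∀ j → liftS σ j ≡ bv (punchIn (suc i) j)
  eσ' zero    = refl
  eσ' (suc j) = cong wk (eσ j)

closeWith-Closes : ∀ x → Closes {0} x zero (λ i → bv (suc i)) (closeVar x zero)
closeWith-Closes x = (λ ()) , λ _ → refl

mutual
  LinSub-close⇒Rep : ∀ {x n} {i : Fin (suc n)} {σ τ} → Closes x i σ τ →
    ∀ s {L v} → LinSub i (sub σ τ s) L v → Rep x s L v
  LinSub-close⇒Rep {i = i} (eσ , eτ) (bv j) d with subst (λ w → LinSub i w _ _) (eσ j) d
  ... | hole e = ⊥-elim (punchInᵢ≢i i j e)
  ... | bound e with punchIn-injective i _ _ e
  ...   | refl = rb
  LinSub-close⇒Rep {x} {i = i} (eσ , eτ) (fv y) d with y ≡ᵇ x in eq | subst (λ w → LinSub i w _ _) (eτ y) d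
  ... | true  | hole refl with ≡ᵇ-true y x eq
  ...   | refl = rx
  LinSub-close⇒Rep {x} {i = i} (eσ , eτ) (fv y) d | true | bound e = ⊥-elim (punchInᵢ≢i i _ e)
  LinSub-close⇒Rep {x} {i = i} (eσ , eτ) (fv y) d | false | free = ry (≡ᵇ-false y x eq)
  LinSub-close⇒Rep cl (lam c) (lam r) = rlam (LinSub-close⇒Rep (Closes-lift cl) c r)
  LinSub-close⇒Rep cl (app t M) (app p r rs) = rapp p (LinSub-close⇒Rep cl t r) (LinSubs-close⇒Reps cl M rs)

  LinSubs-close⇒Reps : ∀ {x n} {i : Fin (suc n)} {σ τ} → Closes x i σ τ →
    ∀ M {L V} → LinSubs i (subL σ τ M) L V → RepL x M L V
  LinSubs-close⇒Reps cl [] nil = []r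
  LinSubs-close⇒Reps cl (m ∷ M) (cons p r rs) = ∷r p (LinSub-close⇒Rep cl m r) (LinSubs-close⇒Reps cl M rs)

mutual
  open-close : ∀ {x n} {i : Fin (suc n)} {σc τc σo τo} → Closes x i σc τc → Opens x i σo τo →
    ∀ s → sub σo τo (sub σc τc s) ≡ s
  open-close {σo = σo} {τo} (cσ , cτ) (oᵢ , oσ , oτ) (bv j) = ≡-trans (cong (sub σo τo) (cσ j)) (oσ j)
  open-close {x} {σo = σo} {τo} (cσ , cτ) (oᵢ , oσ , oτ) (fv y) = ≡-trans (cong (sub σo τo) (cτ y)) open-var
    where
    open-var : sub σo τo (closeVar x _ y) ≡ fv y
    open-var with y ≡ᵇ x in eq
    ... | true  = ≡-trans oᵢ (cong fv (sym (≡ᵇ-true y x eq)))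
    ... | false = oτ y
  open-close cl op (lam c) = cong lam (open-close (Closes-lift cl) (Opens-lift op) c)
  open-close cl op (app t M) = cong₂ app (open-close cl op t) (open-closeL cl op M)

  open-closeL : ∀ {x n} {i : Fin (suc n)} {σc τc σo τo} → Closes x i σc τc → Opens x i σo τo →
    ∀ M → subL σo τo (subL σc τc M) ≡ M
  open-closeL cl op []      = refl
  open-closeL cl op (t ∷ M) = cong₂ _∷_ (open-close cl op t) (open-closeL cl op M)

openWith-closeWith : ∀ x (s : Δ) → openWith x (closeWith x s) ≡ s
openWith-closeWith x s = open-close ((λ ()) , λ _ → refl) (refl , (λ _ → refl) , λ _ → refl) s

mutual
  Occ-sub⁻ : ∀ {z m n} {σ : Fin m → Tm n} {τ : ℕ → Tm n} (t : Tm m) → Occ z (sub σ τ t) →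
    (∃ λ j → Occ z (σ j)) ⊎ (∃ λ y → Occ y t × Occ z (τ y))
  Occ-sub⁻ (fv y) o = inj₂ (y , here , o)
  Occ-sub⁻ (bv j) o = inj₁ (j , o)
  Occ-sub⁻ {σ = σ} {τ} (lam b) (lam o) with Occ-sub⁻ b o
  ... | inj₁ (suc j , o') = inj₁ (j , Occ-ren⁻ suc (σ j) o')
  ... | inj₂ (y , o₁ , o₂) = inj₂ (y , lam o₁ , Occ-ren⁻ suc (τ y) o₂)
  Occ-sub⁻ (app t L) (appH o) = Sum.map₂ (λ (y , o₁ , o₂) → y , appH o₁ , o₂) (Occ-sub⁻ t o)
  Occ-sub⁻ (app t L) (appB o) = Sum.map₂ (λ (y , o₁ , o₂) → y , appB o₁ , o₂) (OccL-subL⁻ L o)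

  OccL-subL⁻ : ∀ {z m n} {σ : Fin m → Tm n} {τ : ℕ → Tm n} (L : List (Tm m)) → Any (Occ z) (subL σ τ L) →
    (∃ λ j → Occ z (σ j)) ⊎ (∃ λ y → Any (Occ y) L × Occ z (τ y))
  OccL-subL⁻ (t ∷ L) (here o)  = Sum.map₂ (λ (y , o₁ , o₂) → y , here o₁ , o₂) (Occ-sub⁻ t o)
  OccL-subL⁻ (t ∷ L) (there o) = Sum.map₂ (λ (y , o₁ , o₂) → y , there o₁ , o₂) (OccL-subL⁻ L o)

mutual
  size-sub-atoms : ∀ {m n} {σ : Fin m → Tm n} {τ : ℕ → Tm n} →
    (∀ j → size (σ j) ≡ 1) → (∀ y → size (τ y) ≡ 1) → ∀ t → size (sub σ τ t) ≡ size t
  size-sub-atoms eσ eτ (fv y) = eτ y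
  size-sub-atoms eσ eτ (bv j) = eσ j
  size-sub-atoms {σ = σ} {τ} eσ eτ (lam b) =
    cong suc (size-sub-atoms eσ' (λ y → ≡-trans (size-ren suc (τ y)) (eτ y)) b)
    where
    eσ' : ∀ j → size (liftS σ j) ≡ 1
    eσ' zero    = refl
    eσ' (suc j) = ≡-trans (size-ren suc (σ j)) (eσ j)
  size-sub-atoms eσ eτ (app t L) = cong suc (cong₂ _+_ (size-sub-atoms eσ eτ t) (sizeL-subL-atoms eσ eτ L))

  sizeL-subL-atoms : ∀ {m n} {σ : Fin m → Tm n} {τ : ℕ → Tm n} →
    (∀ j → size (σ j) ≡ 1) → (∀ y → size (τ y) ≡ 1) → ∀ L → sizeL (subL σ τ L) ≡ sizeL L
  sizeL-subL-atoms eσ eτ []      = refl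
  sizeL-subL-atoms eσ eτ (t ∷ L) = cong₂ _+_ (size-sub-atoms eσ eτ t) (sizeL-subL-atoms eσ eτ L)

size-closeVar : ∀ {n} x (i : Fin (suc n)) y → size (closeVar x i y) ≡ 1
size-closeVar x i y with y ≡ᵇ x
... | true  = refl
... | false = refl

Occ-closeVar : ∀ {n z} x (i : Fin (suc n)) y → Occ z (closeVar x i y) → z ≡ y × y ≢ x
Occ-closeVar x i y o with y ≡ᵇ x in eq | o
... | false | here = refl , ≡ᵇ-false y x eq

size-closeWith : ∀ x (s : Δ) → size (closeWith x s) ≡ size s
size-closeWith x = size-sub-atoms (λ ()) (size-closeVar x zero)

Occ-closeWith⁻ : ∀ {z} x (s : Δ) → Occ z (closeWith x s) → Occ z s × z ≢ x
Occ-closeWith⁻ x s o with Occ-sub⁻ s o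
... | inj₂ (y , o₁ , o₂) with Occ-closeVar x zero y o₂
...   | refl , y≢x = o₁ , y≢x

-- _↝_ may name the bound variable of a β-redex by any name not free in it.
mutual
  maxName : ∀ {n} → Tm n → ℕ
  maxName (fv x)    = x
  maxName (bv _)    = 0
  maxName (lam b)   = maxName b
  maxName (app t L) = maxName t ⊔ maxNameL L

  maxNameL : ∀ {n} → List (Tm n) → ℕ
  maxNameL []      = 0
  maxNameL (t ∷ L) = maxName t ⊔ maxNameL L

mutual
  Occ⇒≤maxName : ∀ {x n} {t : Tm n} → Occ x t → x ≤ maxName t
  Occ⇒≤maxName here = ≤-refl
  Occ⇒≤maxName (lam o) = Occ⇒≤maxName o
  Occ⇒≤maxName (appH {L = L} o) = m≤n⇒m≤n⊔o (maxNameL L) (Occ⇒≤maxName o)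
  Occ⇒≤maxName (appB {t = t} o) = m≤n⇒m≤o⊔n (maxName t) (OccL⇒≤maxNameL o)

  OccL⇒≤maxNameL : ∀ {x n} {L : List (Tm n)} → Any (Occ x) L → x ≤ maxNameL L
  OccL⇒≤maxNameL {L = t ∷ L} (here o)  = m≤n⇒m≤n⊔o (maxNameL L) (Occ⇒≤maxName o)
  OccL⇒≤maxNameL {L = t ∷ L} (there o) = m≤n⇒m≤o⊔n (maxName t) (OccL⇒≤maxNameL o)

fresh∉ : ∀ {n} (t : Tm n) → ¬ Occ (suc (maxName t)) t
fresh∉ t o = n≮n _ (Occ⇒≤maxName o)

openWith-Opens : ∀ {n} x → Opens {n} x zero (λ { zero → fv x ; (suc i) → bv i }) fv
openWith-Opens x = refl , (λ _ → refl) , λ _ → refl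

↝⇒⟶ : ∀ {n} {t u : Tm n} → t ↝ u → t ⟶ u
↝⇒⟶ (β {b = b} x x∉λb _ r) = β⟶ (Rep-open⇒LinSub (openWith-Opens x) b (x∉λb ∘ lam) r)
↝⇒⟶ (lam↝ s)  = lam⟶ (↝⇒⟶ s)
↝⇒⟶ (appH↝ s) = appH⟶ (↝⇒⟶ s)
↝⇒⟶ (appB↝ s) = appB⟶ (↝⇒⟶ s)

⟶⇒↝ : ∀ {n} {t u : Tm n} → t ⟶ u → t ↝ u
⟶⇒↝ (β⟶ {b = b} {L} r) =
  β x (x∉ ∘ appH) (x∉ ∘ appB) (LinSub⇒Rep-open (openWith-Opens x) (x∉ ∘ appH ∘ lam) r)
  where
  x   = suc (maxName (app (lam b) L))
  x∉ = fresh∉ (app (lam b) L)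
⟶⇒↝ (lam⟶ s)  = lam↝ (⟶⇒↝ s)
⟶⇒↝ (appH⟶ s) = appH↝ (⟶⇒↝ s)
⟶⇒↝ (appB⟶ s) = appB↝ (⟶⇒↝ s)

apps : ∀ {n} → Tm n → List (List (Tm n)) → Tm n
apps t []       = t
apps t (L ∷ Ls) = apps (app t L) Ls

InBags : List (List Δ) → List TmSet → Set₁
InBags = Pointwise (λ L a → All a L)

appsS⁻ : ∀ f as {t} → appsS f as t → ∃₂ λ s Ls → t ≡ apps s Ls × f s × InBags Ls as
appsS⁻ f []       m = _ , [] , refl , m , []
appsS⁻ f (a ∷ as) m with appsS⁻ (appS f a) as m
... | _ , Ls , refl , (s , L , fs , aL , refl) , ib = s , L ∷ Ls , refl , fs , aL ∷ ib

appsS⁺ : ∀ f as {s Ls} → f s → InBags Ls as → appsS f as (apps s Ls)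
appsS⁺ f []       fs []        = fs
appsS⁺ f (a ∷ as) fs (aL ∷ ib) = appsS⁺ (appS f a) as (_ , _ , fs , aL , refl) ib

appsS-++ : ∀ f as bs → appsS f (as ++ bs) ≡ appsS (appsS f as) bs
appsS-++ f []       bs = refl
appsS-++ f (a ∷ as) bs = appsS-++ (appS f a) as bs

appS-⊑ : ∀ {f g : TmSet} (a : TmSet) → f ⊑ g → appS f a ⊑ appS g a
appS-⊑ a le (s , L , fs , aL , refl) with le fs
... | s' , gs , p = app s' L , (s' , L , gs , aL , refl) , app≈ p (≈ᴮ-refl L)

⊑-trans : ∀ {f g k : TmSet} → f ⊑ g → g ⊑ k → f ⊑ k
⊑-trans p q m with p m
... | _ , m' , e with q m'
... | t'' , m'' , e' = t'' , m'' , ≈-trans e e'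

≡⇒⊑ : ∀ {f g : TmSet} → f ≡ g → f ⊑ g
≡⇒⊑ refl {t} m = t , m , ≈-refl t

init-last : ∀ {ℓ} {A : Set ℓ} (a : A) as → ∃₂ λ bs b → a ∷ as ≡ bs ++ b ∷ []
init-last a []        = [] , a , refl
init-last a (a' ∷ as) with init-last a' as
... | bs , b , eq = a ∷ bs , b , cong (a ∷_) eq

apps-≈⁻ : ∀ {n} (s : Tm n) Ls {t} → apps s Ls ≈ t →
  ∃₂ λ s' Ls' → t ≡ apps s' Ls' × s ≈ s' × Pointwise _≈ᴮ_ Ls Ls'
apps-≈⁻ s []       p = _ , [] , refl , p , []
apps-≈⁻ s (L ∷ Ls) p with apps-≈⁻ (app s L) Ls p
... | _ , Ls' , refl , app≈ p' q , qs = _ , _ ∷ Ls' , refl , p' , q ∷ qs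

apps-≈⁺ : ∀ {n} {s s' : Tm n} {Ls Ls'} → s ≈ s' → Pointwise _≈ᴮ_ Ls Ls' → apps s Ls ≈ apps s' Ls'
apps-≈⁺ p []       = p
apps-≈⁺ p (q ∷ qs) = apps-≈⁺ (app≈ p q) qs

Bags⟶* : ∀ {n} → List (List (Tm n)) → List (List (Tm n)) → Set
Bags⟶* = Pointwise (Pointwise _⟶*_)

apps-⟶* : ∀ {n} {s s' : Tm n} {Ls Ls'} → s ⟶* s' → Bags⟶* Ls Ls' → apps s Ls ⟶* apps s' Ls'
apps-⟶* r []       = r
apps-⟶* r (p ∷ ps) = apps-⟶* (app-⟶* r p) ps

Pointwise-⟶*-step : ∀ {n} {L₁ L₂} {u u' : Tm n} → u ⟶ u' → Pointwise _⟶*_ (L₁ ++ u ∷ L₂) (L₁ ++ u' ∷ L₂)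
Pointwise-⟶*-step s = PW.++⁺ (PW.refl ε) ((s ◅ ε) ∷ PW.refl ε)

NotLam : ∀ {n} → Tm n → Set
NotLam (lam _) = 𝟘
NotLam _       = ⊤

app-⟶⁻ : ∀ {n} {t : Tm n} {L w} → NotLam t → app t L ⟶ w →
  (∃ λ t' → t ⟶ t' × w ≡ app t' L) ⊎ (∃ λ L' → Pointwise _⟶*_ L L' × w ≡ app t L')
app-⟶⁻ nl (appH⟶ s) = inj₁ (_ , s , refl)
app-⟶⁻ nl (appB⟶ s) = inj₂ (_ , Pointwise-⟶*-step s , refl)

apps-⟶⁻ : ∀ {n} (s : Tm n) Ls {w} → NotLam s → apps s Ls ⟶ w →
  (∃ λ s' → s ⟶ s' × w ≡ apps s' Ls) ⊎ (∃ λ Ls' → Bags⟶* Ls Ls' × w ≡ apps s Ls')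
apps-⟶⁻ s []       nl r = inj₁ (_ , r , refl)
apps-⟶⁻ s (L ∷ Ls) nl r with apps-⟶⁻ (app s L) Ls tt r
... | inj₂ (Ls' , ps , refl) = inj₂ (L ∷ Ls' , PW.refl ε ∷ ps , refl)
... | inj₁ (_ , r' , refl) with app-⟶⁻ nl r'
...   | inj₁ (s' , r'' , refl) = inj₁ (s' , r'' , refl)
...   | inj₂ (L' , p , refl)   = inj₂ (L' ∷ Ls , p ∷ PW.refl (PW.refl ε) , refl)

apps-fv-⟶*⁻ : ∀ {n} x (Ls : List (List (Tm n))) {u} → apps (fv x) Ls ⟶* u →
  ∃ λ Ms → u ≡ apps (fv x) Ms × Bags⟶* Ls Ms
apps-fv-⟶*⁻ x Ls ε = Ls , refl , PW.refl (PW.refl ε)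
apps-fv-⟶*⁻ x Ls (r ◅ rs) with apps-⟶⁻ (fv x) Ls tt r
... | inj₁ (_ , () , _)
... | inj₂ (Ls' , ps , refl) with apps-fv-⟶*⁻ x Ls' rs
...   | Ms , refl , ps' = Ms , refl , PW.transitive (PW.transitive _◅◅_) ps ps'

record LamSpineReduct {n} (b : Tm (suc n)) (L₀ : List (Tm n)) (Ls : List (List (Tm n))) (u : Tm n) : Set where
  constructor reduct
  field
    {body}  : Tm (suc n)
    {bag}   : List (Tm n)
    {spine} : List (List (Tm n))
    body⟶*  : b ⟶* body
    bag⟶*   : Pointwise _⟶*_ L₀ bag
    spine⟶* : Bags⟶* Ls spine
    outcome : u ≡ apps (app (lam body) bag) spine
            ⊎ ∃ λ v → LinSub zero body bag v × apps v spine ⟶* u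

apps-lam-⟶*⁻ : ∀ {n} (b : Tm (suc n)) L₀ Ls {u} → apps (app (lam b) L₀) Ls ⟶* u → LamSpineReduct b L₀ Ls u
apps-lam-⟶*⁻ b L₀ Ls ε = reduct ε (PW.refl ε) (PW.refl (PW.refl ε)) (inj₁ refl)
apps-lam-⟶*⁻ b L₀ Ls (r ◅ rs) with apps-⟶⁻ (app (lam b) L₀) Ls tt r
... | inj₂ (Ls' , ps , refl) with apps-lam-⟶*⁻ b L₀ Ls' rs
...   | reduct sb p₀ ps' out = reduct sb p₀ (PW.transitive (PW.transitive _◅◅_) ps ps') out
apps-lam-⟶*⁻ b L₀ Ls (r ◅ rs) | inj₁ (_ , β⟶ l , refl) = reduct ε (PW.refl ε) (PW.refl (PW.refl ε)) (inj₂ (_ , l , rs))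
apps-lam-⟶*⁻ b L₀ Ls (r ◅ rs) | inj₁ (_ , appH⟶ (lam⟶ s) , refl) with apps-lam-⟶*⁻ _ L₀ Ls rs
... | reduct sb p₀ ps out = reduct (s ◅ sb) p₀ ps out
apps-lam-⟶*⁻ b L₀ Ls (r ◅ rs) | inj₁ (_ , appB⟶ s , refl) with apps-lam-⟶*⁻ b _ Ls rs
... | reduct sb p₀ ps out = reduct sb (PW.transitive _◅◅_ (Pointwise-⟶*-step s) p₀) ps out

-- Finite sets as bounded sets

Within : ℕ → List ℕ → Δ → Set
Within N V t = size t ≤ N × FvIn t V

Within-≼ : ∀ {N V} {t u : Δ} → u ≼ t → Within N V t → Within N V u
Within-≼ (s , o) (sN , fV) = ≤-trans s sN , λ z oz → fV z (o oz)

Bounded : TmSet → Set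
Bounded X = ∃₂ λ N V → ∀ {t} → X t → Within N V t

mutual
  fvs : ∀ {n} → Tm n → List ℕ
  fvs (fv x)    = x ∷ []
  fvs (bv _)    = []
  fvs (lam b)   = fvs b
  fvs (app t L) = fvs t ++ fvsL L

  fvsL : ∀ {n} → List (Tm n) → List ℕ
  fvsL []      = []
  fvsL (t ∷ L) = fvs t ++ fvsL L

mutual
  Occ⇒∈fvs : ∀ {x n} {t : Tm n} → Occ x t → x ∈ fvs t
  Occ⇒∈fvs here     = here refl
  Occ⇒∈fvs (lam o)  = Occ⇒∈fvs o
  Occ⇒∈fvs (appH o) = ∈-++⁺ˡ (Occ⇒∈fvs o)
  Occ⇒∈fvs (appB {t = t} o) = ∈-++⁺ʳ (fvs t) (OccL⇒∈fvsL o)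

  OccL⇒∈fvsL : ∀ {x n} {L : List (Tm n)} → Any (Occ x) L → x ∈ fvsL L
  OccL⇒∈fvsL (here o) = ∈-++⁺ˡ (Occ⇒∈fvs o)
  OccL⇒∈fvsL {L = t ∷ L} (there o) = ∈-++⁺ʳ (fvs t) (OccL⇒∈fvsL o)

maxSize : List Δ → ℕ
maxSize []      = 0
maxSize (t ∷ F) = size t ⊔ maxSize F

Within-∈ : ∀ {F t} → t ∈ F → Within (maxSize F) (concatMap fvs F) t
Within-∈ (here refl) = m≤m⊔n _ _ , λ x o → ∈-++⁺ˡ (Occ⇒∈fvs o)
Within-∈ {t' ∷ F} (there i) with Within-∈ i
... | sN , fV = m≤n⇒m≤o⊔n (size t') sN , λ x o → ∈-++⁺ʳ (fvs t') (fV x o)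

Finite⇒Bounded : ∀ {X} → Finite X → Bounded X
Finite⇒Bounded (F , cov) = maxSize F , concatMap fvs F , λ m →
  let _ , i , p = find (cov m) in Within-≼ (≈⇒≼ p) (Within-∈ i)

lists : ∀ {A : Set} → ℕ → List A → List (List A)
lists zero    S = [] ∷ []
lists (suc k) S = [] ∷ cartesianProductWith _∷_ S (lists k S)

∈-lists : ∀ {A : Set} k (S : List A) {L} → length L ≤ k → All (_∈ S) L → L ∈ lists k S
∈-lists zero    S {[]} _ _ = here refl
∈-lists (suc k) S {[]} _ _ = here refl
∈-lists (suc k) S {x ∷ L} (s≤s le) (i ∷ is) = there (∈-cartesianProductWith⁺ _∷_ i (∈-lists k S le is))

terms : ℕ → (n : ℕ) → List ℕ → List (Tm n)
terms zero    n V = []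
terms (suc N) n V =
  map fv V ++ map bv (allFin n) ++ map lam (terms N (suc n) V) ++
  cartesianProductWith app (terms N n V) (lists N (terms N n V))

∈-terms : ∀ N {n} (t : Tm n) V → size t ≤ N → (∀ x → Occ x t → x ∈ V) → t ∈ terms N n V
∈-terms (suc N) (fv x) V le fV = ∈-++⁺ˡ (∈-map⁺ fv (fV x here))
∈-terms (suc N) (bv i) V le fV = ∈-++⁺ʳ (map fv V) (∈-++⁺ˡ (∈-map⁺ bv (∈-allFin i)))
∈-terms (suc N) {n} (lam b) V (s≤s le) fV =
  ∈-++⁺ʳ (map fv V) (∈-++⁺ʳ (map bv (allFin n)) (∈-++⁺ˡ (∈-map⁺ lam (∈-terms N b V le (λ x → fV x ∘ lam)))))
∈-terms (suc N) {n} (app t L) V (s≤s le) fV =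
  ∈-++⁺ʳ (map fv V) (∈-++⁺ʳ (map bv (allFin n)) (∈-++⁺ʳ (map lam (terms N (suc n) V))
    (∈-cartesianProductWith⁺ app
      (∈-terms N t V (≤-trans (m≤m+n _ _) le) (λ x → fV x ∘ appH))
      (∈-lists N _ (≤-trans (length≤sizeL L) sizeL≤N) (elements L (λ i → ≤-trans (∈⇒size≤sizeL i) sizeL≤N) (λ x → fV x ∘ appB))))))
  where
  sizeL≤N : sizeL L ≤ N
  sizeL≤N = ≤-trans (m≤n+m _ _) le
  elements : ∀ K → (∀ {u} → u ∈ K → size u ≤ N) → (∀ x → Any (Occ x) K → x ∈ V) → All (_∈ terms N n V) K
  elements []      _ _ = []
  elements (u ∷ K) f g = ∈-terms N u V (f (here refl)) (λ x → g x ∘ here) ∷ elements K (f ∘ there) (λ x → g x ∘ there)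

Bounded⇒Finite : ∀ {X} → Bounded X → Finite X
Bounded⇒Finite (N , V , f) = terms N 0 V , λ {t} m → lose (∈-terms N t V (proj₁ (f m)) (proj₂ (f m))) (≈-refl t)

Bounded-≼ : ∀ {X Y} → (∀ {t} → X t → ∃ λ w → Y w × t ≼ w) → Bounded Y → Bounded X
Bounded-≼ f (N , V , g) = N , V , λ m → let _ , yw , t≼w = f m in Within-≼ t≼w (g yw)

Bounded-⊎ : ∀ {X Y Z} → (∀ {t} → X t → Y t ⊎ Z t) → Bounded Y → Bounded Z → Bounded X
Bounded-⊎ f (N₁ , V₁ , g₁) (N₂ , V₂ , g₂) = N₁ ⊔ N₂ , V₁ ++ V₂ , λ m → [ left , right ]′ (f m)
  where
  left : ∀ {t} → _ → Within (N₁ ⊔ N₂) (V₁ ++ V₂) t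
  left y = let sN , fV = g₁ y in m≤n⇒m≤n⊔o N₂ sN , λ x o → ∈-++⁺ˡ (fV x o)
  right : ∀ {t} → _ → Within (N₁ ⊔ N₂) (V₁ ++ V₂) t
  right z = let sN , fV = g₂ z in m≤n⇒m≤o⊔n N₁ sN , λ x o → ∈-++⁺ʳ V₁ (fV x o)

_⊴_ : Δ → Δ → Set
t ⊴ w = size t ≤ 2 + 2 * size w × (∀ {z} → Occ z t → Occ z w)

Bounded-⊴ : ∀ {X Y} → (∀ {t} → X t → ∃ λ w → Y w × t ⊴ w) → Bounded Y → Bounded X
Bounded-⊴ f (N , V , g) = 2 + 2 * N , V , λ m →
  let _ , yw , sz , occ = f m ; sN , fV = g yw in ≤-trans sz (+-monoʳ-≤ 2 (*-monoʳ-≤ 2 sN)) , λ x o → fV x (occ o)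

-- Linear substitution erases nothing: the body and the bag both survive in the contractum.
redex⊴contractum : ∀ {b L v} → LinSub zero b L v → app (lam b) L ⊴ v
redex⊴contractum {b} {L} {v} r = s≤s (s≤s size-bound) , occ
  where
  size-bound : size b + sizeL L ≤ size v + (size v + 0)
  size-bound = begin
    size b + sizeL L     ≡⟨ LinSub-size r ⟨
    size v + length L    ≤⟨ +-monoʳ-≤ (size v) (≤-trans (length≤sizeL L) (sizeL≤LinSub r)) ⟩
    size v + size v      ≡⟨ cong (size v +_) (+-identityʳ (size v)) ⟨
    size v + (size v + 0) ∎
    where open ≤-Reasoning
  occ : ∀ {z} → Occ z (app (lam b) L) → Occ z v
  occ (appH (lam o)) = LinSub-Occ-term⁺ r o
  occ (appB o)       = LinSub-Occ-bag⁺ r o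

apps-⊴ : ∀ {s s'} Ls → s ⊴ s' → apps s Ls ⊴ apps s' Ls
apps-⊴ []       le = le
apps-⊴ {s} {s'} (L ∷ Ls) (sz , occ) = apps-⊴ Ls (s≤s (≤-trans (+-monoˡ-≤ (sizeL L) sz) (arith (size s') (sizeL L))) , occ')
  where
  arith : ∀ a b → 2 + 2 * a + b ≤ suc (2 * suc (a + b))
  arith a b = ≤-trans (m≤m+n (2 + 2 * a + b) (1 + b)) (≤-reflexive (expand a b))
    where
    expand : ∀ a b → (2 + 2 * a + b) + (1 + b) ≡ suc (2 * suc (a + b))
    expand = solve-∀
  occ' : ∀ {z} → Occ z (app s L) → Occ z (app s' L)
  occ' (appH o) = appH (occ o)
  occ' (appB o) = appB o

app-FvIn : ∀ {s L V₁ V₂} → FvIn s V₁ → (∀ {m} → m ∈ L → FvIn m V₂) → FvIn (app s L) (V₁ ++ V₂)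
app-FvIn fs fL x (appH o) = ∈-++⁺ˡ (fs x o)
app-FvIn fs fL x (appB o) = let _ , i , o' = find o in ∈-++⁺ʳ _ (fL i x o')

app-h≤ : ∀ {s L N₁ N₂} → h s ≤ N₁ → (∀ {m} → m ∈ L → h m ≤ N₂) → h (app s L) ≤ suc (N₁ + N₂)
app-h≤ {L = L} {N₁} {N₂} hs hm = s≤s (≤-trans (⊔-mono-≤ hs (hL≤ L hm)) (m⊔n≤m+n N₁ N₂))
  where
  hL≤ : ∀ {N} (M : List Δ) → (∀ {m} → m ∈ M → h m ≤ N) → hL M ≤ N
  hL≤ []      f = z≤n
  hL≤ (m ∷ M) f = ⊔-lub (f (here refl)) (hL≤ M (f ∘ there))

app-Within : ∀ {s L N₁ N₂ V₁ V₂ K} → Within N₁ V₁ s → (∀ {m} → m ∈ L → Within N₂ V₂ m) → length L ≤ K →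
  Within (suc (N₁ + K * N₂)) (V₁ ++ V₂) (app s L)
app-Within {L = L} {N₂ = N₂} (sN , fs) wL lenL =
  s≤s (+-mono-≤ sN (≤-trans (sizeL≤length*max L (proj₁ ∘ wL)) (*-monoˡ-≤ N₂ lenL))) ,
  app-FvIn fs (proj₂ ∘ wL)

Shrinking : (Δ → Δ → Set) → Set
Shrinking R = ∀ {t u} → R t u → u ≼ t

≡-shrinking : Shrinking _≡_
≡-shrinking refl = ≼-refl

-- Lift R: steps of an application that never contract it at the root.
data Lift (R : Δ → Δ → Set) : Δ → Δ → Set where
  lift : ∀ {t t' L L'} → R t t' → Pointwise _⟶*_ L L' → Lift R (app t L) (app t' L')

Lift^ : ℕ → (Δ → Δ → Set) → Δ → Δ → Set
Lift^ zero    R = R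
Lift^ (suc k) R = Lift^ k (Lift R)

apps-Lift^ : ∀ {R s s' Ls Ms} → R s s' → Bags⟶* Ls Ms → Lift^ (length Ls) R (apps s Ls) (apps s' Ms)
apps-Lift^ r []       = r
apps-Lift^ r (p ∷ ps) = apps-Lift^ (lift r p) ps

sizeL-⟶* : ∀ {n} {L L' : List (Tm n)} → Pointwise _⟶*_ L L' → sizeL L' ≤ sizeL L
sizeL-⟶* []       = z≤n
sizeL-⟶* (r ∷ rs) = +-mono-≤ (proj₁ (⟶*⇒≽ r)) (sizeL-⟶* rs)

OccL-⟶*⁻ : ∀ {z n} {L L' : List (Tm n)} → Pointwise _⟶*_ L L' → Any (Occ z) L' → Any (Occ z) L
OccL-⟶*⁻ (r ∷ rs) (here o)  = here (proj₂ (⟶*⇒≽ r) o)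
OccL-⟶*⁻ (r ∷ rs) (there o) = there (OccL-⟶*⁻ rs o)

Lift-shrinking : ∀ {R} → Shrinking R → Shrinking (Lift R)
Lift-shrinking sh (lift r rs) = s≤s (+-mono-≤ (proj₁ (sh r)) (sizeL-⟶* rs)) , occ
  where
  occ : ∀ {z} → Occ z _ → Occ z _
  occ (appH o) = appH (proj₂ (sh r) o)
  occ (appB o) = appB (OccL-⟶*⁻ rs o)

Reaches : (Δ → Δ → Set) → TmSet → TmSet
Reaches R a t = ∃ λ t₁ → ∃ λ u → ∃ λ s → t ≈ t₁ × R t₁ u × u ≈ s × a s

Reaches-≼ : ∀ {R a t} → Shrinking R → Reaches R a t → ∃ λ s → a s × s ≼ t
Reaches-≼ sh (_ , _ , s , p , r , q , as) = s , as , ≼-trans (≈⇒≼ (≈-sym q)) (≼-trans (sh r) (≈⇒≼ (≈-sym p)))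

Reaches-≈ : ∀ {R a t t'} → t ≈ t' → Reaches R a t → Reaches R a t'
Reaches-≈ p' (_ , _ , _ , p , r , q , as) = _ , _ , _ , ≈-trans (≈-sym p') p , r , q , as

Reaches-mono : ∀ {R a b} → a ⊆ b → Reaches R a ⊆ Reaches R b
Reaches-mono a⊆b (_ , _ , _ , p , r , q , as) = _ , _ , _ , p , r , q , a⊆b as

bag-Reaches : ∀ {R L L₁ M M₀} → L ≈ᴮ L₁ → Pointwise R L₁ M → M ≈ᴮ M₀ → ∀ {m} → m ∈ L → Reaches R (_∈ M₀) m
bag-Reaches q rs q' i with ≈ᴮ-∈ q i
... | m₁ , i₁ , p with Pointwise-∈ˡ rs i₁
... | m₂ , i₂ , r with ≈ᴮ-∈ q' i₂
... | m₃ , i₃ , p' = m₁ , m₂ , m₃ , p , r , p' , i₃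

bag-Reaches⁻ : ∀ {R L L₁ M M₀} → L ≈ᴮ L₁ → Pointwise R L₁ M → M ≈ᴮ M₀ →
  ∀ {m₀} → m₀ ∈ M₀ → ∃ λ m → m ∈ L × Reaches R (_≡ m₀) m
bag-Reaches⁻ q rs q' i₃ with ≈ᴮ-∈ (≈ᴮ-sym q') i₃
... | m₂ , i₂ , p' with Pointwise-∈ʳ rs i₂
... | m₁ , i₁ , r with ≈ᴮ-∈ (≈ᴮ-sym q) i₁
... | m , i , p = m , i , m₁ , m₂ , _ , ≈-sym p , r , ≈-sym p' , refl

data UnderLam : Δ → Δ → Set where
  underLam : ∀ {b b'} → b ⟶* b' → UnderLam (lam b) (lam b')

UnderLam-shrinking : Shrinking UnderLam
UnderLam-shrinking (underLam r) = s≤s (proj₁ (⟶*⇒≽ r)) , λ { (lam o) → lam (proj₂ (⟶*⇒≽ r) o) }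

lamS-spine-dichotomy : ∀ x e f₀ fs a {t} → (appsS (appS (lamS x e) f₀) fs ∩ Reaches _⟶*_ a) t →
  (appsS (appS (lamS x e) f₀) fs ∩ Reaches (Lift^ (suc (length fs)) UnderLam) a) t
  ⊎ ∃ λ w → (appsS (repS e x f₀) fs ∩ Reaches _⟶*_ a) w × t ⊴ w
lamS-spine-dichotomy x e f₀ fs a (m , (_ , _ , _ , p , r , q , as)) with appsS⁻ _ fs m
... | _ , Ls , refl , (_ , L₀ , (s , es , refl) , fL₀ , refl) , ib with apps-≈⁻ _ Ls p
... | _ , Ls₁ , refl , app≈ (lam≈ pb) pL₀ , pLs with apps-lam-⟶*⁻ _ _ Ls₁ r
... | reduct sb p₀ ps (inj₁ refl) = inj₁ (m , _ , _ , _ , p , lift-spine , q , as)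
  where
  lift-spine : Lift^ (suc (length fs)) UnderLam _ _
  lift-spine = subst (λ k → Lift^ (suc k) UnderLam _ _) (≡-trans (sym (Pointwise-length pLs)) (Pointwise-length ib))
                     (apps-Lift^ (lift (underLam sb) p₀) ps)
... | reduct sb p₀ ps (inj₂ (_ , l , rs)) with LinSub-bag-⟶* l p₀
... | _ , l₃ , r₃ with LinSub-⟶*-postpone sb l₃
... | _ , l₄ , r₄ with LinSub-≈ l₄ (≈-sym pb) pL₀
... | v₀ , l₀ , e₀ = inj₂ (apps v₀ Ls , (w∈ , w-reaches) , apps-⊴ Ls (redex⊴contractum l₀))
  where
  w∈ : appsS (repS e x f₀) fs (apps v₀ Ls)
  w∈ = appsS⁺ (repS e x f₀) fs (s , L₀ , es , fL₀ , LinSub-close⇒Rep (closeWith-Closes x) s l₀) ib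
  w-reaches : Reaches _⟶*_ a (apps v₀ Ls)
  w-reaches = _ , _ , _ , apps-≈⁺ e₀ pLs , apps-⟶* (r₄ ◅◅ r₃) ps ◅◅ rs , q , as

-- The structure (↑𝔗)^⊥

module Orthogonal (𝔗 : Struct) (disp : Dispersed 𝔗) (her : Hereditary 𝔗) (expd : Expandable 𝔗) where

  𝔖 : Struct
  𝔖 = (↑S 𝔗) ⊥

  subset-closed : ∀ a b → 𝔗 a → b ⊆ a → 𝔗 b
  subset-closed = proj₁ her

  π₀-closed : ∀ a → 𝔗 a → 𝔗 (π₀ a)
  π₀-closed = proj₁ (proj₂ her)

  π₁-closed : ∀ a → 𝔗 a → 𝔗 (π₁ a)
  π₁-closed = proj₁ (proj₂ (proj₂ her))

  πv-closed : ∀ x a → 𝔗 a → NotFree x a → 𝔗 (πv x a)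
  πv-closed = proj₂ (proj₂ (proj₂ her))

  Up : TmSet → TmSet
  Up = Reaches _⟶*_

  Up-≋-↑ : ∀ a → Up a ≋ ↑ a
  Up-≋-↑ a = (λ (t₁ , u , s , p , r , q , as) → t₁ , (s , as , u , gmap id ⟶⇒↝ r , q) , p)
           , (λ {t} (s , as , u , r , q) → t , (t , u , s , ≈-refl t , gmap id ↝⇒⟶ r , q , as) , ≈-refl t)

  𝔖⇒Bounded : ∀ {X} → 𝔖 X → ∀ a → 𝔗 a → Bounded (X ∩ Up a)
  𝔖⇒Bounded SX a Ta = Finite⇒Bounded (SX (Up a) (a , Ta , Up-≋-↑ a))

  Bounded⇒𝔖 : ∀ {X} → (∀ a → 𝔗 a → Bounded (X ∩ Up a)) → 𝔖 X
  Bounded⇒𝔖 {X} f d (a , Ta , d⊑↑a , _) = Bounded⇒Finite (Bounded-≼ into-Up (f a Ta))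
    where
    into-Up : ∀ {t} → (X ∩ d) t → ∃ λ w → (X ∩ Up a) w × t ≼ w
    into-Up {t} (xt , dt) with d⊑↑a dt
    ... | t' , (s , as , u , r , q) , p = t , (xt , t' , u , s , p , gmap id ↝⇒⟶ r , q , as) , ≼-refl

  𝔖-⊑-closed : ∀ {X Y} → X ⊑ Y → 𝔖 Y → 𝔖 X
  𝔖-⊑-closed {X} {Y} X⊑Y SY = Bounded⇒𝔖 λ a Ta → Bounded-≼ (to-Y a) (𝔖⇒Bounded SY a Ta)
    where
    to-Y : ∀ a {t} → (X ∩ Up a) t → ∃ λ w → (Y ∩ Up a) w × t ≼ w
    to-Y a (xt , up) with X⊑Y xt
    ... | w , yw , p = w , (yw , Reaches-≈ p up) , ≈⇒≼ p

  -- Dispersion bounds the number of arguments, through the reduct in a.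
  appS-bounded : ∀ {Hd R c a} → Shrinking R → 𝔖 c → 𝔗 a →
    Bounded (Hd ∩ Reaches R (π₀ a)) → Bounded (appS Hd c ∩ Reaches (Lift R) a)
  appS-bounded {Hd} {R} {c} {a} sh Sc Ta (N₁ , V₁ , head-bd)
    with 𝔖⇒Bounded Sc (π₁ a) (π₁-closed a Ta)
  ... | N₂ , V₂ , arg-bd with Finite⇒Bounded (disp a Ta (suc (N₁ + N₂)) (V₁ ++ V₂))
  ... | K , _ , redex-bd = suc (N₁ + K * N₂) , V₁ ++ V₂ , within
    where
    within : ∀ {t} → (appS Hd c ∩ Reaches (Lift R) a) t → Within (suc (N₁ + K * N₂)) (V₁ ++ V₂) t
    within ((s , L , Hs , cL , refl) , (_ , _ , _ , app≈ p q , lift r rs , app≈ {t' = s₀} {M = M₀} p' q' , as₀)) =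
      app-Within s-within args length≤K
      where
      s-reaches : Reaches R (π₀ a) s
      s-reaches = _ , _ , _ , p , r , p' , M₀ , as₀
      s-within : Within N₁ V₁ s
      s-within = head-bd (Hs , s-reaches)
      args : ∀ {m} → m ∈ L → Within N₂ V₂ m
      args i = arg-bd (All.lookup cL i , Reaches-mono (λ j → s₀ , M₀ , as₀ , j) (bag-Reaches q rs q' i))
      s₀-within : Within N₁ V₁ s₀
      s₀-within = Within-≼ (proj₂ (proj₂ (Reaches-≼ sh s-reaches))) s-within
      args₀ : ∀ {m₀} → m₀ ∈ M₀ → Within N₂ V₂ m₀
      args₀ i₀ with bag-Reaches⁻ q rs q' i₀
      ... | _ , i , reach with Reaches-≼ ⟶*⇒≽ reach
      ...   | _ , refl , m₀≼m = Within-≼ m₀≼m (args i)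
      redex-within : Within K _ (app s₀ M₀)
      redex-within = redex-bd (as₀ ,
        app-h≤ (≤-trans (h≤size s₀) (proj₁ s₀-within)) (λ i → ≤-trans (h≤size _) (proj₁ (args₀ i))) ,
        app-FvIn (proj₂ s₀-within) (proj₂ ∘ args₀))
      length≤K : length L ≤ K
      length≤K = begin
        length L        ≡⟨ ≡-trans (≈ᴮ-length q) (≡-trans (Pointwise-length rs) (≈ᴮ-length q')) ⟩
        length M₀       ≤⟨ ≤-trans (length≤sizeL M₀) (≤-trans (m≤n+m _ _) (n≤1+n _)) ⟩
        size (app s₀ M₀) ≤⟨ proj₁ redex-within ⟩
        K               ∎
        where open ≤-Reasoning

  appsS-bounded : ∀ cs → All 𝔖 cs → ∀ {Hd R} → Shrinking R → (∀ a → 𝔗 a → Bounded (Hd ∩ Reaches R a)) →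
    ∀ a → 𝔗 a → Bounded (appsS Hd cs ∩ Reaches (Lift^ (length cs) R) a)
  appsS-bounded []       []          sh base = base
  appsS-bounded (c ∷ cs) (Sc ∷ Scs) sh base = appsS-bounded cs Scs (Lift-shrinking sh)
    λ a Ta → appS-bounded sh Sc Ta (base (π₀ a) (π₀-closed a Ta))

  var-spine∈𝔖 : ∀ x cs → All 𝔖 cs → 𝔖 (appsS (single (fv x)) cs)
  var-spine∈𝔖 x cs Scs = Bounded⇒𝔖 λ a Ta →
    Bounded-≼ (reaches-along-args a) (appsS-bounded cs Scs ≡-shrinking var-bounded a Ta)
    where
    var-bounded : ∀ a → 𝔗 a → Bounded (single (fv x) ∩ Reaches _≡_ a)
    var-bounded a Ta = 1 , x ∷ [] , λ { (fv≈ , _) → ≤-refl , λ { _ here → here refl } }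
    X = appsS (single (fv x)) cs
    reaches-along-args : ∀ a {t} → (X ∩ Up a) t → ∃ λ w → (X ∩ Reaches (Lift^ (length cs) _≡_) a) w × t ≼ w
    reaches-along-args a {t} (m , (_ , _ , _ , p , r , q , as)) with appsS⁻ _ cs m
    ... | _ , Ls , refl , fv≈ , ib with apps-≈⁻ (fv x) Ls p
    ...   | _ , Ls₁ , refl , fv≈ , ps with apps-fv-⟶*⁻ x Ls₁ r
    ...     | Ms , refl , rs = t , (m , _ , _ , _ , p , lift-spine , q , as) , ≼-refl
      where
      same-length : length Ls₁ ≡ length cs
      same-length = ≡-trans (sym (Pointwise-length ps)) (Pointwise-length ib)
      lift-spine : Lift^ (length cs) _≡_ (apps (fv x) Ls₁) (apps (fv x) Ms)
      lift-spine = subst (λ k → Lift^ k _≡_ _ _) same-length (apps-Lift^ refl rs)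

  lamS-bounded : ∀ x e → 𝔖 e → ∀ a → 𝔗 a → Bounded (lamS x e ∩ Reaches UnderLam a)
  lamS-bounded x e Se a Ta with 𝔖⇒Bounded Se (πv x A) (πv-closed x A (subset-closed a A Ta proj₁) proj₂)
    where
    A : TmSet
    A t = a t × ¬ Occ x t
  ... | N , V , body-bd = suc N , V , within
    where
    within : ∀ {t} → (lamS x e ∩ Reaches UnderLam a) t → Within (suc N) V t
    within ((s , es , refl) , (_ , _ , _ , lam≈ {b' = b₁} p , underLam {b' = b'} r , lam≈ {b' = b₀} q , as₀)) =
      s≤s (≤-trans (≤-reflexive (size-closeWith x s)) (proj₁ s-within)) ,
      λ { z (lam o) → proj₂ s-within z (proj₁ (Occ-closeWith⁻ x s o)) }
      where
      x∉λb₀ : ¬ Occ x (lam b₀)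
      x∉λb₀ (lam o) = proj₂ (Occ-closeWith⁻ x s (Occ-≈ (≈-sym p) (proj₂ (⟶*⇒≽ r) (Occ-≈ (≈-sym q) o)))) refl
      s-reaches : Up (πv x (λ t → a t × ¬ Occ x t)) s
      s-reaches = openWith x b₁ , openWith x b' , openWith x b₀ ,
        subst (_≈ openWith x b₁) (openWith-closeWith x s) (sub-≈ _ fv p) , sub-⟶* _ fv r , sub-≈ _ fv q ,
        b₀ , (as₀ , x∉λb₀) , refl
      s-within : Within N V s
      s-within = body-bd (es , s-reaches)

  saturated : Saturated 𝔖 𝔖
  saturated x e f₀ fs Se Sf₀ Sfs Srep = Bounded⇒𝔖 λ a Ta →
    Bounded-⊎ (lamS-spine-dichotomy x e f₀ fs a)
      (appsS-bounded (f₀ ∷ fs) (Sf₀ ∷ Sfs) UnderLam-shrinking (lamS-bounded x e Se) a Ta)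
      (Bounded-⊴ id (𝔖⇒Bounded Srep a Ta))

  𝒩⊆𝔖 : ∀ c → 𝒩 𝔖 c → 𝔖 c
  𝒩⊆𝔖 c (inj₁ (x , c⊑x , _)) = 𝔖-⊑-closed c⊑x (var-spine∈𝔖 x [] [])
  𝒩⊆𝔖 c (inj₂ (x , a₁ , as , Sas , c⊑spine , _)) = 𝔖-⊑-closed c⊑spine (var-spine∈𝔖 x (a₁ ∷ as) Sas)

  𝒩⊆𝔖⇒𝒩 : 𝒩 𝔖 ⊆S (𝔖 ⇒S 𝒩 𝔖)
  𝒩⊆𝔖⇒𝒩 c (inj₁ (x , le , ge)) a Sa = inj₂ (x , a , [] , Sa ∷ [] , appS-⊑ a le , appS-⊑ a ge)
  𝒩⊆𝔖⇒𝒩 c (inj₂ (x , a₁ , as , Sas , le , ge)) a Sa =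
    inj₂ (x , a₁ , as ++ a ∷ [] , All.++⁺ Sas (Sa ∷ []) ,
          ⊑-trans (appS-⊑ a le) (≡⇒⊑ (sym snoc)) , ⊑-trans (≡⇒⊑ snoc) (appS-⊑ a ge))
    where snoc = appsS-++ (single (fv x)) (a₁ ∷ as) (a ∷ [])

  ∅ : TmSet
  ∅ _ = 𝟘

  ∅∈𝔖 : 𝔖 ∅
  ∅∈𝔖 _ _ = [] , λ { (() , _) }

  -- Applied to the empty set, f must already be a variable-headed spine.
  𝔖⇒𝒩⊆𝒩⇒𝔖 : (𝔖 ⇒S 𝒩 𝔖) ⊆S (𝒩 𝔖 ⇒S 𝔖)
  𝔖⇒𝒩⊆𝒩⇒𝔖 f H c Nc with H ∅ ∅∈𝔖
  ... | inj₁ (x , _ , x⊑f∅) with x⊑f∅ fv≈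
  ...   | _ , (_ , _ , _ , _ , refl) , ()
  𝔖⇒𝒩⊆𝒩⇒𝔖 f H c Nc | inj₂ (x , a₁ , as , Sas , f∅⊑spine , _) with init-last a₁ as
  ... | bs , b , split = 𝔖-⊑-closed (⊑-trans (appS-⊑ c f⊑init) (≡⇒⊑ (sym (appsS-++ X bs (c ∷ [])))))
                          (var-spine∈𝔖 x (bs ++ c ∷ []) (All.++⁺ Sbs (𝒩⊆𝔖 c Nc ∷ [])))
    where
    X = single (fv x)
    Sbs : All 𝔖 bs
    Sbs = All.++⁻ˡ bs (subst (All 𝔖) split Sas)
    spine⊑ : appsS X (a₁ ∷ as) ⊑ appS (appsS X bs) b
    spine⊑ = ≡⇒⊑ (≡-trans (cong (appsS X) split) (appsS-++ X bs (b ∷ [])))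
    f⊑init : f ⊑ appsS X bs
    f⊑init {s} fs with ⊑-trans f∅⊑spine spine⊑ (s , [] , fs , [] , refl)
    ... | _ , (s' , _ , s'∈ , _ , refl) , app≈ s≈s' _ = s' , s'∈ , s≈s'

  -- By expandability, testing ⟨f⟩[0] against ⟨a⟩[0] bounds f against a.
  𝒩⇒𝔖⊆𝔖 : (𝒩 𝔖 ⇒S 𝔖) ⊆S 𝔖
  𝒩⇒𝔖⊆𝔖 f H = Bounded⇒𝔖 λ a Ta → Bounded-≼ (apply-to-fv0 a) (𝔖⇒Bounded f0∈𝔖 _ (expd a Ta 0))
    where
    f0∈𝔖 : 𝔖 (appS f (single (fv 0)))
    f0∈𝔖 = H (single (fv 0)) (inj₁ (0 , (λ {t} m → t , m , ≈-refl t) , (λ {t} m → t , m , ≈-refl t)))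
    apply-to-fv0 : ∀ a {t} → (f ∩ Up a) t →
      ∃ λ w → (appS f (single (fv 0)) ∩ Up (λ w → ∃ λ s → a s × w ≡ app s (fv 0 ∷ []))) w × t ≼ w
    apply-to-fv0 a {t} (ft , (_ , _ , _ , p , r , q , as)) =
      app t (fv 0 ∷ []) ,
      ((t , _ , ft , fv≈ ∷ [] , refl) ,
       (_ , _ , _ , app≈ p (≈ᴮ-refl _) , appH-⟶* r , app≈ q (≈ᴮ-refl _) , (_ , as , refl))) ,
      ≤-trans (m≤m+n (size t) 1) (n≤1+n _) , appH

  ∪-closed : ∀ a b → 𝔖 a → 𝔖 b → 𝔖 (a ∪ b)
  ∪-closed a b Sa Sb d Td with Sa d Td | Sb d Td
  ... | F₁ , cover₁ | F₂ , cover₂ = F₁ ++ F₂ ,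
    λ { (inj₁ at , dt) → Any.++⁺ˡ (cover₁ (at , dt)) ; (inj₂ bt , dt) → Any.++⁺ʳ F₁ (cover₂ (bt , dt)) }

  adapted : Adapted 𝔖
  adapted = saturated , 𝒩⊆𝔖⇒𝒩 , 𝔖⇒𝒩⊆𝒩⇒𝔖 , 𝒩⇒𝔖⊆𝔖 , ∪-closed

lemma3 : (𝔗 : Struct) → Dispersed 𝔗 → Hereditary 𝔗 → Expandable 𝔗 → Adapted ((↑S 𝔗) ⊥)
lemma3 𝔗 disp her expd = Orthogonal.adapted 𝔗 disp her expd
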